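{- For every composition $\alpha$ and positive integer $n$, $A_{\alpha,n}=B_{\alpha,n}$, where $A_{\alpha,n}=\{\beta:\beta=w(\alpha)\ne0\text{ for some }w\in CRHW_n\}$ and $B_{\alpha,n}=\{\beta:\alpha<_c\beta\text{ and }\beta/\!\!/\alpha\text{ is an nc border strip of size }n\}$.
   Context: A composition is a finite sequence $\alpha=(\alpha_1,\ldots,\alpha_k)$ of positive integers; $l(\alpha)=k$, $|\alpha|=\sum\alpha_i$; its diagram is the set of boxes $(i,j)$ with $1\le i\le k$, $1\le j\le\alpha_i$ (rows top to bottom). Write $\alpha\lessdot_c\beta$ if $\beta=(1,\alpha_1,\ldots,\alpha_k)$, or $\beta$ is obtained from $\alpha$ by increasing a part $\alpha_m$ by one where $\alpha_i\ne\alpha_m$ for all $i<m$; $<_c$ is the transitive closure. If $\alpha<_c\beta$ and $d=l(\beta)-l(\alpha)$, $\beta/\!\!/\alpha$ is the set of boxes of the diagram of $\beta$ not of the form $(i'+d,j)$ with $j\le\alpha_{i'}$; its size is $|\beta|-|\alpha|$; its support is the set of columns containing its boxes; it is an interval shape if its support is a set of consecutive integers. An interval shape is an nc border strip if (1) whenever $(i,1),(i,2)\in\beta/\!\!/\alpha$, the box $(i,1)$ is the bottommost box of column 1 of $\beta/\!\!/\alpha$; (2) whenever $(i,j),(i,j+1)\in\beta/\!\!/\alpha$ with $j\ge2$, $(i,j)$ is the topmost box of column $j$ of $\beta/\!\!/\alpha$. Box-adding operators: $\mathfrak{t}_1(\alpha)=(1,\alpha_1,\ldots,\alpha_k)$;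 for $i\ge2$, $\mathfrak{t}_i(\alpha)$ increases by one the leftmost part equal to $i-1$ if one exists, else is $0$; $\mathfrak{t}_i(0)=0$. A word $w=\mathfrak{t}_{i_1}\cdots\mathfrak{t}_{i_n}$ acts by $w(\alpha)=\mathfrak{t}_{i_1}(\cdots\mathfrak{t}_{i_n}(\alpha)\cdots)$. It is a reverse hookword if for some $0\le k\le n-1$, $i_1\le\cdots\le i_{k+1}>i_{k+2}>\cdots>i_n$, connected if $\{i_1,\ldots,i_n\}$ is a set of consecutive integers; $CRHW_n$ is the set of connected reverse hookwords of length $n$. -}

module Defs where

open import Data.Nat using (ℕ; zero; suc; _+_; _∸_; _≤_; _<_; _>_; _≡ᵇ_)
open import Data.List using (List; []; _∷_; _++_; length; [_])
open import Data.Nat.ListAction using (sum)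
open import Data.List.Relation.Unary.All using (All)
open import Data.List.Relation.Unary.Linked using (Linked)
open import Data.List.Membership.Propositional using (_∈_)
open import Data.Maybe using (Maybe; just; nothing; _>>=_)
import Data.Maybe as Maybe
open import Data.Bool using (if_then_else_)
open import Data.Product using (Σ; _×_; ∃)
open import Relation.Nullary using (¬_)
open import Relation.Binary.PropositionalEquality using (_≡_; _≢_)
open import Relation.Binary.Construct.Closure.Transitive using (TransClosure)

IsComposition : List ℕ → Set
IsComposition α = All (λ x → 0 < x) α

∣_∣ : List ℕ → ℕ
∣ α ∣ = sum α

-- Box-adding operators; `nothing` plays the role of 0.

incLeftmost : ℕ → List ℕ → Maybe (List ℕ)
incLeftmost x [] = nothing
incLeftmost x (y ∷ ys) =
  if y ≡ᵇ x then just (suc y ∷ ys) else Maybe.map (y ∷_) (incLeftmost x ys)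

-- t i (for i ≥ 1; t 0 is unused and defined as 0)
t : ℕ → List ℕ → Maybe (List ℕ)
t zero α = nothing
t (suc zero) α = just (1 ∷ α)
t (suc (suc k)) α = incLeftmost (suc k) α

-- a word i₁ ⋯ iₙ (as the list [i₁,…,iₙ]) acting: w(α) = t_{i₁}(⋯ t_{iₙ}(α)⋯),
-- with t_i(0) = 0
act : List ℕ → List ℕ → Maybe (List ℕ)
act [] α = just α
act (i ∷ w) α = act w α >>= t i

IsReverseHookword : List ℕ → Set
IsReverseHookword w =
  Σ (List ℕ) λ u → Σ ℕ λ x → Σ (List ℕ) λ v →
    (w ≡ u ++ x ∷ v) × Linked _≤_ (u ++ [ x ]) × Linked _>_ (x ∷ v)

IsConnected : List ℕ → Set
IsConnected w = ∀ a b c → a ∈ w → c ∈ w → a ≤ b → b ≤ c → b ∈ w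

InCRHW : ℕ → List ℕ → Set
InCRHW n w = All (λ i → 0 < i) w × length w ≡ n × IsReverseHookword w × IsConnected w

data _⋖c_ : List ℕ → List ℕ → Set where
  prepend1 : ∀ α → α ⋖c (1 ∷ α)
  increase : ∀ pre x post → All (λ y → y ≢ x) pre →
             (pre ++ x ∷ post) ⋖c (pre ++ suc x ∷ post)

_<c_ : List ℕ → List ℕ → Set
_<c_ = TransClosure _⋖c_

-- 1-based part lookup; 0 out of range
part : List ℕ → ℕ → ℕ
part [] i = 0
part (x ∷ xs) zero = 0
part (x ∷ xs) (suc zero) = x
part (x ∷ xs) (suc (suc i)) = part xs (suc i)

InDiagram : List ℕ → ℕ → ℕ → Set
InDiagram α i j = 1 ≤ i × i ≤ length α × 1 ≤ j × j ≤ part α i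

InSkew : List ℕ → List ℕ → ℕ → ℕ → Set
InSkew β α i j =
  InDiagram β i j ×
  ¬ (Σ ℕ λ i' → (i ≡ i' + (length β ∸ length α)) × InDiagram α i' j)

skewSize : List ℕ → List ℕ → ℕ
skewSize β α = ∣ β ∣ ∸ ∣ α ∣

InSupport : List ℕ → List ℕ → ℕ → Set
InSupport β α j = ∃ λ i → InSkew β α i j

IsIntervalShape : List ℕ → List ℕ → Set
IsIntervalShape β α =
  ∀ a b c → InSupport β α a → InSupport β α c → a ≤ b → b ≤ c → InSupport β α b

IsNCBorderStrip : List ℕ → List ℕ → Set
IsNCBorderStrip β α =
  IsIntervalShape β α ×
  (∀ i → InSkew β α i 1 → InSkew β α i 2 → ∀ i' → InSkew β α i' 1 → i' ≤ i) ×
  (∀ i j → 2 ≤ j → InSkew β α i j → InSkew β α i (suc j) →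
     ∀ i' → InSkew β α i' j → i ≤ i')

InA : List ℕ → ℕ → List ℕ → Set
InA α n β = Σ (List ℕ) λ w → InCRHW n w × act w α ≡ just β

InB : List ℕ → ℕ → List ℕ → Set
InB α n β = α <c β × IsNCBorderStrip β α × skewSize β α ≡ n

-- A word acts on a composition row by row.  In the order of application, a reverse hookword is a
-- strictly increasing run of letters followed by a weakly decreasing one, and each row, from the
-- top, greedily absorbs consecutive letters x + 1, x + 2, … continuing its current length x, at
-- most one of them from the decreasing run; the other letters pass on to the rows below, and
-- letters 1 create new rows on top.  So the letters of the word are the columns of the boxes of
-- β//α counted with multiplicity, which gives the size and the interval condition, and the way
-- rows absorb letters gives the nc conditions.  Conversely, for an nc border strip, take as
-- increasing run the columns j such that some row has boxes in columns j and j + 1, followed by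
-- the last column, and put all remaining boxes into the decreasing run: the nc conditions say
-- exactly that every row then absorbs its own boxes.

module Submission where

open import Data.Bool using (true; false; if_then_else_)
open import Data.Empty using (⊥; ⊥-elim)
open import Data.List using (List; []; _∷_; _++_; _∷ʳ_; length; [_]; reverse; replicate; map; zip)
open import Data.List.Membership.Propositional using (_∈_)
open import Data.List.Properties
  using (∷-injective; ++-assoc; ++-conicalˡ; ++-conicalʳ; length-++; length-map; length-replicate; length-reverse;
         length-zipWith; zipWith-replicate;
         reverse-++; reverse-involutive; unfold-reverse; ++-identityʳ)
open import Data.List.Relation.Unary.All using (All; []; _∷_)
import Data.List.Relation.Unary.All as All
import Data.List.Relation.Unary.All.Properties as Allₚ
open import Data.List.Relation.Unary.AllPairs using (AllPairs; []; _∷_)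
import Data.List.Relation.Unary.AllPairs as AllPairs
import Data.List.Relation.Unary.AllPairs.Properties as AllPairsₚ
open import Data.List.Relation.Unary.Any using (Any; here; there; any?)
import Data.List.Relation.Unary.Any.Properties as Anyₚ
open import Data.List.Relation.Unary.Linked using (Linked)
open import Data.List.Relation.Unary.Linked.Properties using (Linked⇒AllPairs; AllPairs⇒Linked)
open import Data.Maybe using (Maybe; just; nothing; _>>=_)
import Data.Maybe as Maybe
open import Data.Nat using (ℕ; zero; suc; _+_; _∸_; _≤_; _<_; _>_; _≥_; _⊔_; _⊓_; _≡ᵇ_; z≤n; s≤s)
open import Data.Nat.ListAction using (sum)
open import Data.Nat.Properties
open import Data.Product using (Σ; _×_; _,_; proj₁; proj₂)
import Data.Product as Product
open import Data.Sum using (_⊎_; inj₁; inj₂)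
open import Function.Bundles using (_⇔_; mk⇔)
import Relation.Binary.Construct.Closure.Transitive as TC
open import Relation.Binary.Definitions using (tri<; tri≈; tri>)
open import Relation.Binary.PropositionalEquality hiding ([_])
open import Relation.Nullary using (¬_; Dec; yes; no)
open import Relation.Nullary.Decidable using (_×-dec_)

open import Defs

private
  variable
    A B : Set

≡ᵇ-refl : ∀ n → (n ≡ᵇ n) ≡ true
≡ᵇ-refl zero = refl
≡ᵇ-refl (suc n) = ≡ᵇ-refl n

≡ᵇ-false : ∀ m n → m ≢ n → (m ≡ᵇ n) ≡ false
≡ᵇ-false zero zero p = ⊥-elim (p refl)
≡ᵇ-false zero (suc n) p = refl
≡ᵇ-false (suc m) zero p = refl
≡ᵇ-false (suc m) (suc n) p = ≡ᵇ-false m n (λ e → p (cong suc e))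

mult : ℕ → List ℕ → ℕ
mult c [] = 0
mult c (x ∷ xs) = if x ≡ᵇ c then suc (mult c xs) else mult c xs

mult-≡ : ∀ c xs → mult c (c ∷ xs) ≡ suc (mult c xs)
mult-≡ c xs rewrite ≡ᵇ-refl c = refl

mult-≢ : ∀ c x xs → x ≢ c → mult c (x ∷ xs) ≡ mult c xs
mult-≢ c x xs ne rewrite ≡ᵇ-false x c ne = refl

mult-++ : ∀ c xs ys → mult c (xs ++ ys) ≡ mult c xs + mult c ys
mult-++ c [] ys = refl
mult-++ c (x ∷ xs) ys with x ≟ c
... | yes refl rewrite mult-≡ x (xs ++ ys) | mult-≡ x xs = cong suc (mult-++ x xs ys)
... | no ne rewrite mult-≢ c x (xs ++ ys) ne | mult-≢ c x xs ne = mult-++ c xs ys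

mult-reverse : ∀ c xs → mult c (reverse xs) ≡ mult c xs
mult-reverse c [] = refl
mult-reverse c (x ∷ xs) = begin
  mult c (reverse (x ∷ xs))           ≡⟨ cong (mult c) (unfold-reverse x xs) ⟩
  mult c (reverse xs ++ [ x ])        ≡⟨ mult-++ c (reverse xs) [ x ] ⟩
  mult c (reverse xs) + mult c [ x ]  ≡⟨ cong (_+ mult c [ x ]) (mult-reverse c xs) ⟩
  mult c xs + mult c [ x ]            ≡⟨ +-comm (mult c xs) _ ⟩
  mult c [ x ] + mult c xs            ≡⟨ mult-++ c [ x ] xs ⟨
  mult c (x ∷ xs)                     ∎
  where open ≡-Reasoning

mult>0⇒∈ : ∀ c xs → 0 < mult c xs → c ∈ xs
mult>0⇒∈ c (x ∷ xs) pos with x ≟ c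
... | yes refl = here refl
... | no ne rewrite mult-≢ c x xs ne = there (mult>0⇒∈ c xs pos)

∈⇒mult>0 : ∀ c xs → c ∈ xs → 0 < mult c xs
∈⇒mult>0 c (x ∷ xs) (here refl) rewrite mult-≡ c xs = s≤s z≤n
∈⇒mult>0 c (x ∷ xs) (there m) with x ≟ c
... | yes refl rewrite mult-≡ x xs = s≤s z≤n
... | no ne rewrite mult-≢ c x xs ne = ∈⇒mult>0 c xs m

All-mult>0 : ∀ {P : ℕ → Set} {c xs} → All P xs → 0 < mult c xs → P c
All-mult>0 ps pos = All.lookup ps (mult>0⇒∈ _ _ pos)

All¬⇒mult≡0 : ∀ {P : ℕ → Set} c xs → All P xs → ¬ P c → mult c xs ≡ 0
All¬⇒mult≡0 c xs ps ¬pc = n≤0⇒n≡0 (≮⇒≥ (λ pos → ¬pc (All-mult>0 ps pos)))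

mult≡0⇒[] : ∀ xs → (∀ c → mult c xs ≡ 0) → xs ≡ []
mult≡0⇒[] [] _ = refl
mult≡0⇒[] (x ∷ xs) all-zero = ⊥-elim (1+n≢0 (trans (sym (mult-≡ x xs)) (all-zero x)))

mult-replicate-≡ : ∀ j c → mult c (replicate j c) ≡ j
mult-replicate-≡ zero c = refl
mult-replicate-≡ (suc j) c = trans (mult-≡ c (replicate j c)) (cong suc (mult-replicate-≡ j c))

mult-replicate-≢ : ∀ j c d → d ≢ c → mult c (replicate j d) ≡ 0
mult-replicate-≢ j c d d≢c =
  All¬⇒mult≡0 {P = _≡ d} c (replicate j d) (Allₚ.replicate⁺ j refl) (λ c≡d → d≢c (sym c≡d))

mult-strict≤1 : ∀ c xs → AllPairs _<_ xs → mult c xs ≤ 1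
mult-strict≤1 c [] [] = z≤n
mult-strict≤1 c (x ∷ xs) (x<xs ∷ _) with x ≟ c
... | yes refl rewrite mult-≡ x xs | All¬⇒mult≡0 x xs x<xs (<-irrefl refl) = ≤-refl
mult-strict≤1 c (x ∷ xs) (_ ∷ xs<) | no ne rewrite mult-≢ c x xs ne = mult-strict≤1 c xs xs<

mult-strict≡1 : ∀ c xs → AllPairs _<_ xs → 0 < mult c xs → mult c xs ≡ 1
mult-strict≡1 c xs inc pos = ≤-antisym (mult-strict≤1 c xs inc) pos

All-reverse⁺ : ∀ {P : A → Set} xs → All P xs → All P (reverse xs)
All-reverse⁺ [] [] = []
All-reverse⁺ (x ∷ xs) (p ∷ ps) rewrite unfold-reverse x xs = Allₚ.∷ʳ⁺ (All-reverse⁺ xs ps) p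

AllPairs-∷ʳ⁺ : ∀ {R : A → A → Set} {xs x} → AllPairs R xs → All (λ y → R y x) xs → AllPairs R (xs ∷ʳ x)
AllPairs-∷ʳ⁺ [] [] = [] ∷ []
AllPairs-∷ʳ⁺ (a ∷ ap) (r ∷ rs) = Allₚ.∷ʳ⁺ a r ∷ AllPairs-∷ʳ⁺ ap rs

AllPairs-∷ʳ⁻ : ∀ {R : A → A → Set} xs {x} → AllPairs R (xs ∷ʳ x) → AllPairs R xs × All (λ y → R y x) xs
AllPairs-∷ʳ⁻ [] _ = [] , []
AllPairs-∷ʳ⁻ (y ∷ xs) (a ∷ ap) with Allₚ.∷ʳ⁻ a | AllPairs-∷ʳ⁻ xs ap
... | a' , r | ap' , rs = a' ∷ ap' , r ∷ rs

AllPairs-reverse⁺ : ∀ {R : A → A → Set} xs → AllPairs R xs → AllPairs (λ a b → R b a) (reverse xs)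
AllPairs-reverse⁺ [] [] = []
AllPairs-reverse⁺ (x ∷ xs) (a ∷ ap) rewrite unfold-reverse x xs =
  AllPairs-∷ʳ⁺ (AllPairs-reverse⁺ xs ap) (All-reverse⁺ xs a)

run : List ℕ → List ℕ → Maybe (List ℕ)
run [] α = just α
run (c ∷ s) α = t c α >>= run s

run-++ : ∀ s s' α → run (s ++ s') α ≡ (run s α >>= run s')
run-++ [] s' α = refl
run-++ (c ∷ s) s' α with t c α
... | nothing = refl
... | just β = run-++ s s' β

>>=-t≡>>=-run : ∀ i (m : Maybe (List ℕ)) → (m >>= t i) ≡ (m >>= run [ i ])
>>=-t≡>>=-run i nothing = refl
>>=-t≡>>=-run i (just x) with t i x
... | nothing = refl
... | just y = refl

act≡run-reverse : ∀ w α → act w α ≡ run (reverse w) α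
act≡run-reverse [] α = refl
act≡run-reverse (i ∷ w) α = begin
  (act w α >>= t i)                  ≡⟨ cong (_>>= t i) (act≡run-reverse w α) ⟩
  (run (reverse w) α >>= t i)        ≡⟨ >>=-t≡>>=-run i (run (reverse w) α) ⟩
  (run (reverse w) α >>= run [ i ])  ≡⟨ run-++ (reverse w) [ i ] α ⟨
  run (reverse w ++ [ i ]) α         ≡⟨ cong (λ s → run s α) (unfold-reverse i w) ⟨
  run (reverse (i ∷ w)) α            ∎
  where open ≡-Reasoning

incLeftmost-just : ∀ x α β → incLeftmost x α ≡ just β →
  Σ (List ℕ) λ pre → Σ (List ℕ) λ post →
    (α ≡ pre ++ x ∷ post) × (β ≡ pre ++ suc x ∷ post) × All (_≢ x) pre
incLeftmost-just x (y ∷ ys) β e with y ≟ x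
... | yes refl rewrite ≡ᵇ-refl y with e
...   | refl = [] , ys , refl , refl , []
incLeftmost-just x (y ∷ ys) β e | no y≢x rewrite ≡ᵇ-false y x y≢x with incLeftmost x ys in eq
incLeftmost-just x (y ∷ ys) β refl | no y≢x | just ys' with incLeftmost-just x ys ys' eq
... | pre , post , refl , refl , pre≢x = y ∷ pre , post , refl , refl , y≢x ∷ pre≢x

t⇒⋖c : ∀ c α β → t c α ≡ just β → α ⋖c β
t⇒⋖c (suc zero) α .(1 ∷ α) refl = prepend1 α
t⇒⋖c (suc (suc k)) α β e with incLeftmost-just (suc k) α β e
... | pre , post , refl , refl , pre≢x = increase pre (suc k) post pre≢x

sum-incMiddle : ∀ pre x post → sum (pre ++ suc x ∷ post) ≡ suc (sum (pre ++ x ∷ post))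
sum-incMiddle [] x post = refl
sum-incMiddle (y ∷ pre) x post = trans (cong (y +_) (sum-incMiddle pre x post)) (+-suc y _)

t-sum : ∀ c α β → t c α ≡ just β → sum β ≡ suc (sum α)
t-sum (suc zero) α .(1 ∷ α) refl = refl
t-sum (suc (suc k)) α β e with incLeftmost-just (suc k) α β e
... | pre , post , refl , refl , _ = sum-incMiddle pre (suc k) post

run-sum : ∀ s α β → run s α ≡ just β → sum β ≡ length s + sum α
run-sum [] α β refl = refl
run-sum (c ∷ s) α β e with t c α in eq
... | just δ = begin
  sum β                  ≡⟨ run-sum s δ β e ⟩
  length s + sum δ       ≡⟨ cong (length s +_) (t-sum c α δ eq) ⟩
  length s + suc (sum α) ≡⟨ +-suc (length s) (sum α) ⟩
  suc (length s + sum α) ∎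
  where open ≡-Reasoning

run-skewSize : ∀ s α β → run s α ≡ just β → skewSize β α ≡ length s
run-skewSize s α β e = trans (cong (_∸ sum α) (run-sum s α β e)) (m+n∸n≡m (length s) (sum α))

run⇒<c : ∀ s α β → 0 < length s → run s α ≡ just β → α <c β
run⇒<c (c ∷ s) α β _ e with t c α in eq
run⇒<c (c ∷ []) α β _ refl | just δ = TC.[ t⇒⋖c c α δ eq ]
run⇒<c (c ∷ c' ∷ s) α β _ e | just δ = t⇒⋖c c α δ eq TC.∷ run⇒<c (c' ∷ s) δ β (s≤s z≤n) e

replicate-∷ : ∀ k (x : A) xs → replicate k x ++ x ∷ xs ≡ x ∷ replicate k x ++ xs
replicate-∷ zero x xs = refl
replicate-∷ (suc k) x xs = cong (x ∷_) (replicate-∷ k x xs)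

run-ones : ∀ k γ → run (replicate k 1) γ ≡ just (replicate k 1 ++ γ)
run-ones zero γ = refl
run-ones (suc k) γ = trans (run-ones k (1 ∷ γ)) (cong just (replicate-∷ k 1 γ))

-- The row transducer

Row : Set
Row = ℕ × ℕ

InRow : Row → ℕ → Set
InRow (a , g) c = a < c × c ≤ g

inRow? : ∀ r c → Dec (InRow r c)
inRow? (a , g) c = (a <? c) ×-dec (c ≤? g)

absorb : ℕ → List ℕ → ℕ × List ℕ
absorb x [] = x , []
absorb x (c ∷ s) = if c ≡ᵇ suc x then absorb (suc x) s else (proj₁ (absorb x s) , c ∷ proj₂ (absorb x s))

runRows : List ℕ → List ℕ → Maybe (List ℕ)
runRows [] [] = just []
runRows [] (_ ∷ _) = nothing
runRows (x ∷ xs) s = Maybe.map (proj₁ (absorb x s) ∷_) (runRows xs (proj₂ (absorb x s)))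

absorb-All : ∀ {P : ℕ → Set} x s → All P s → All P (proj₂ (absorb x s))
absorb-All x [] [] = []
absorb-All x (c ∷ s) (pc ∷ ps) with c ≡ᵇ suc x
... | true = absorb-All (suc x) s ps
... | false = pc ∷ absorb-All x s ps

absorb-++ : ∀ x S D → absorb x (S ++ D) ≡
  (proj₁ (absorb (proj₁ (absorb x S)) D) , proj₂ (absorb x S) ++ proj₂ (absorb (proj₁ (absorb x S)) D))
absorb-++ x [] D = refl
absorb-++ x (c ∷ S) D with c ≡ᵇ suc x
... | true = absorb-++ (suc x) S D
... | false = cong (λ p → proj₁ p , c ∷ proj₂ p) (absorb-++ x S D)

-- A letter c ≥ 2 lengthens the first row exactly when that row has length c − 1 at that
-- moment, so the first row absorbs its letters greedily and passes on the others.
run-firstRow : ∀ x xs s → All (2 ≤_) s →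
  run s (x ∷ xs) ≡ Maybe.map (proj₁ (absorb x s) ∷_) (run (proj₂ (absorb x s)) xs)
run-firstRow x xs [] _ = refl
run-firstRow x xs (suc zero ∷ s) (s≤s () ∷ _)
run-firstRow x xs (suc (suc k) ∷ s) (_ ∷ ps) with x ≟ suc k
... | yes refl rewrite ≡ᵇ-refl k = run-firstRow (suc (suc k)) xs s ps
... | no x≢k+1 rewrite ≡ᵇ-false x (suc k) x≢k+1 | ≡ᵇ-false (suc k) x (λ e → x≢k+1 (sym e))
  with incLeftmost (suc k) xs
...   | nothing = refl
...   | just ys = run-firstRow x ys s ps

run≡runRows : ∀ xs s → All (2 ≤_) s → run s xs ≡ runRows xs s
run≡runRows [] [] _ = refl
run≡runRows [] (suc (suc k) ∷ s) _ = refl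
run≡runRows [] (zero ∷ s) (() ∷ _)
run≡runRows [] (suc zero ∷ s) (s≤s () ∷ _)
run≡runRows (x ∷ xs) s ps = trans (run-firstRow x xs s ps)
  (cong (Maybe.map _) (run≡runRows xs (proj₂ (absorb x s)) (absorb-All x s ps)))

record AbsorbIncreasing (x : ℕ) (S : List ℕ) (y : ℕ) (S' : List ℕ) : Set₁ where
  field
    start≤end : x ≤ y
    absorbed∈ : ∀ c → InRow (x , y) c → 0 < mult c S
    next∉ : mult (suc y) S ≡ 0
    absorbed∉rest : ∀ c → InRow (x , y) c → mult c S' ≡ 0
    rest-mult : ∀ c → ¬ InRow (x , y) c → mult c S' ≡ mult c S
    rest-increasing : AllPairs _<_ S'
    rest-All : ∀ {P : ℕ → Set} → All P S → All P S'

absorb-increasing-next : ∀ x S {y S'} → All (suc x <_) S → AbsorbIncreasing (suc x) S y S' →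
  AbsorbIncreasing x (suc x ∷ S) y S'
absorb-increasing-next x S {y} {S'} x+1<S ih = record
  { start≤end = ≤-trans (n≤1+n x) IH.start≤end
  ; absorbed∈ = absorbed∈
  ; next∉ = next∉
  ; absorbed∉rest = absorbed∉rest
  ; rest-mult = rest-mult
  ; rest-increasing = IH.rest-increasing
  ; rest-All = λ { (_ ∷ ps) → IH.rest-All ps } }
  where
  module IH = AbsorbIncreasing ih
  absorbed∈ : ∀ c → InRow (x , y) c → 0 < mult c (suc x ∷ S)
  absorbed∈ c (a , b) with c ≟ suc x
  ... | yes refl rewrite mult-≡ (suc x) S = s≤s z≤n
  ... | no ne rewrite mult-≢ c (suc x) S (λ e → ne (sym e)) = IH.absorbed∈ c (≤∧≢⇒< a (λ e → ne (sym e)) , b)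
  next∉ : mult (suc y) (suc x ∷ S) ≡ 0
  next∉ rewrite mult-≢ (suc y) (suc x) S (λ e → <-irrefl e (s≤s IH.start≤end)) = IH.next∉
  absorbed∉rest : ∀ c → InRow (x , y) c → mult c S' ≡ 0
  absorbed∉rest c (a , b) with c ≟ suc x
  ... | yes refl = trans (IH.rest-mult (suc x) (λ (p , _) → <-irrefl refl p))
                    (All¬⇒mult≡0 (suc x) S x+1<S (<-irrefl refl))
  ... | no ne = IH.absorbed∉rest c (≤∧≢⇒< a (λ e → ne (sym e)) , b)
  rest-mult : ∀ c → ¬ InRow (x , y) c → mult c S' ≡ mult c (suc x ∷ S)
  rest-mult c c∉ with c ≟ suc x
  ... | yes refl = ⊥-elim (c∉ (≤-refl , IH.start≤end))
  ... | no ne rewrite mult-≢ c (suc x) S (λ e → ne (sym e)) = IH.rest-mult c (λ (a , b) → c∉ (<-trans (n<1+n x) a , b))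

absorb-increasing-skip : ∀ x c S {y S'} → c ≢ suc x → All (c <_) S → AbsorbIncreasing x S y S' →
  AbsorbIncreasing x (c ∷ S) y (c ∷ S')
absorb-increasing-skip x c S {y} {S'} c≢x+1 c<S ih = record
  { start≤end = IH.start≤end
  ; absorbed∈ = λ d r → subst (0 <_) (sym (mult-c∷ d r)) (IH.absorbed∈ d r)
  ; next∉ = next∉
  ; absorbed∉rest = absorbed∉rest
  ; rest-mult = rest-mult
  ; rest-increasing = IH.rest-All c<S ∷ IH.rest-increasing
  ; rest-All = λ { (p ∷ ps) → p ∷ IH.rest-All ps } }
  where
  module IH = AbsorbIncreasing ih
  -- c > x + 1, and x + 1 ∈ S whenever x < y, so c cannot lie in (x, y].
  c∉ : ¬ InRow (x , y) c
  c∉ (a , b) = <-asym x+1<c (All-mult>0 c<S (IH.absorbed∈ (suc x) (≤-refl , ≤-trans (<⇒≤ x+1<c) b)))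
    where x+1<c = ≤∧≢⇒< a (λ e → c≢x+1 (sym e))
  mult-c∷ : ∀ d → InRow (x , y) d → mult d (c ∷ S) ≡ mult d S
  mult-c∷ d r with c ≟ d
  ... | yes refl = ⊥-elim (c∉ r)
  ... | no ne = mult-≢ d c S ne
  next∉ : mult (suc y) (c ∷ S) ≡ 0
  next∉ with c ≟ suc y
  ... | no ne rewrite mult-≢ (suc y) c S ne = IH.next∉
  ... | yes refl with m≤n⇒m<n∨m≡n IH.start≤end
  ...   | inj₂ e = ⊥-elim (c≢x+1 (cong suc (sym e)))
  ...   | inj₁ x<y = ⊥-elim (<-irrefl refl (<-trans (All-mult>0 c<S (IH.absorbed∈ (suc x) (≤-refl , x<y))) (s≤s x<y)))
  absorbed∉rest : ∀ d → InRow (x , y) d → mult d (c ∷ S') ≡ 0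
  absorbed∉rest d r with c ≟ d
  ... | yes refl = ⊥-elim (c∉ r)
  ... | no ne rewrite mult-≢ d c S' ne = IH.absorbed∉rest d r
  rest-mult : ∀ d → ¬ InRow (x , y) d → mult d (c ∷ S') ≡ mult d (c ∷ S)
  rest-mult d d∉ with c ≟ d
  ... | yes refl rewrite mult-≡ c S' | mult-≡ c S = cong suc (IH.rest-mult c d∉)
  ... | no ne rewrite mult-≢ d c S' ne | mult-≢ d c S ne = IH.rest-mult d d∉

absorb-increasing : ∀ x S → AllPairs _<_ S → AbsorbIncreasing x S (proj₁ (absorb x S)) (proj₂ (absorb x S))
absorb-increasing x [] [] = record
  { start≤end = ≤-refl ; absorbed∈ = λ c (a , b) → ⊥-elim (<-irrefl refl (<-≤-trans a b)) ; next∉ = refl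
  ; absorbed∉rest = λ _ _ → refl ; rest-mult = λ _ _ → refl ; rest-increasing = [] ; rest-All = λ _ → [] }
absorb-increasing x (c ∷ S) (c<S ∷ S<) with c ≟ suc x
... | yes refl rewrite ≡ᵇ-refl x = absorb-increasing-next x S c<S (absorb-increasing (suc x) S S<)
... | no c≢x+1 rewrite ≡ᵇ-false c (suc x) c≢x+1 = absorb-increasing-skip x c S c≢x+1 c<S (absorb-increasing x S S<)

absorb-nothing : ∀ y D → mult (suc y) D ≡ 0 → absorb y D ≡ (y , D)
absorb-nothing y [] _ = refl
absorb-nothing y (d ∷ D) e with d ≟ suc y
... | yes refl rewrite mult-≡ (suc y) D = ⊥-elim (1+n≢0 e)
... | no ne rewrite ≡ᵇ-false d (suc y) ne | absorb-nothing y D e = refl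

record AbsorbDecreasing (y : ℕ) (D : List ℕ) (D' : List ℕ) : Set₁ where
  field
    next-absorbed : mult (suc y) D ≡ suc (mult (suc y) D')
    rest-mult : ∀ c → c ≢ suc y → mult c D' ≡ mult c D
    rest-decreasing : AllPairs _≥_ D'
    rest-All : ∀ {P : ℕ → Set} → All P D → All P D'

-- In a weakly decreasing stream a row can absorb at most one letter, the first copy of y + 1.
absorb-decreasing : ∀ y D → AllPairs _≥_ D → 0 < mult (suc y) D →
  (proj₁ (absorb y D) ≡ suc y) × AbsorbDecreasing y D (proj₂ (absorb y D))
absorb-decreasing y (d ∷ D) (d≥D ∷ D≥) pos with d ≟ suc y
... | yes refl rewrite ≡ᵇ-refl y | absorb-nothing (suc y) D (All¬⇒mult≡0 (suc (suc y)) D d≥D (<-irrefl refl)) =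
  refl , record { next-absorbed = mult-≡ (suc y) D
                ; rest-mult = λ c ne → sym (mult-≢ c (suc y) D (λ e → ne (sym e)))
                ; rest-decreasing = D≥ ; rest-All = λ { (_ ∷ ps) → ps } }
... | no ne rewrite ≡ᵇ-false d (suc y) ne with absorb-decreasing y D D≥ pos
...   | e , sp = e , record
  { next-absorbed = trans (mult-≢ (suc y) d D ne)
                      (trans (IH.next-absorbed) (sym (cong suc (mult-≢ (suc y) d (proj₂ (absorb y D)) ne))))
  ; rest-mult = rest-mult
  ; rest-decreasing = IH.rest-All d≥D ∷ IH.rest-decreasing
  ; rest-All = λ { (p ∷ ps) → p ∷ IH.rest-All ps } }
  where
  module IH = AbsorbDecreasing sp
  rest-mult : ∀ c → c ≢ suc y → mult c (d ∷ proj₂ (absorb y D)) ≡ mult c (d ∷ D)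
  rest-mult c c≢ with d ≟ c
  ... | yes refl rewrite mult-≡ d (proj₂ (absorb y D)) | mult-≡ d D = cong suc (IH.rest-mult d c≢)
  ... | no ne' rewrite mult-≢ c d (proj₂ (absorb y D)) ne' | mult-≢ c d D ne' = IH.rest-mult c c≢

record AbsorbRow (x : ℕ) (S D : List ℕ) (y : ℕ) (S' D' : List ℕ) : Set₁ where
  field
    absorb≡ : absorb x (S ++ D) ≡ (y , S' ++ D')
    start≤end : x ≤ y
    inner∈S : ∀ c → x < c → c < y → 0 < mult c S
    absorbed∉S' : ∀ c → InRow (x , y) c → mult c S' ≡ 0
    S'-mult : ∀ c → ¬ InRow (x , y) c → mult c S' ≡ mult c S
    absorbed-mult : ∀ c → InRow (x , y) c → suc (mult c (S' ++ D')) ≡ mult c (S ++ D)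
    rest-mult : ∀ c → ¬ InRow (x , y) c → mult c (S' ++ D') ≡ mult c (S ++ D)
    S'-increasing : AllPairs _<_ S'
    D'-decreasing : AllPairs _≥_ D'
    S'-All : ∀ {P : ℕ → Set} → All P S → All P S'
    D'-All : ∀ {P : ℕ → Set} → All P D → All P D'
    halt : mult (suc y) (S ++ D) ≡ 0 ⊎ (mult y S ≡ 0 × x < y)

absorb-row-within-S : ∀ x S D → AllPairs _<_ S → AllPairs _≥_ D →
  AbsorbIncreasing x S (proj₁ (absorb x S)) (proj₂ (absorb x S)) → mult (suc (proj₁ (absorb x S))) D ≡ 0 →
  AbsorbRow x S D (proj₁ (absorb x S)) (proj₂ (absorb x S)) D
absorb-row-within-S x S D S< D≥ sp next∉D = record
  { absorb≡ = trans (absorb-++ x S D) (cong (λ p → proj₁ p , S1 ++ proj₂ p) (absorb-nothing y D next∉D))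
  ; start≤end = Sp.start≤end
  ; inner∈S = λ c a b → Sp.absorbed∈ c (a , <⇒≤ b)
  ; absorbed∉S' = Sp.absorbed∉rest
  ; S'-mult = Sp.rest-mult
  ; absorbed-mult = absorbed-mult
  ; rest-mult = λ c r → trans (mult-++ c S1 D) (trans (cong (_+ mult c D) (Sp.rest-mult c r)) (sym (mult-++ c S D)))
  ; S'-increasing = Sp.rest-increasing
  ; D'-decreasing = D≥
  ; S'-All = Sp.rest-All
  ; D'-All = λ p → p
  ; halt = inj₁ (trans (mult-++ (suc y) S D) (cong₂ _+_ Sp.next∉ next∉D)) }
  where
  module Sp = AbsorbIncreasing sp
  y = proj₁ (absorb x S)
  S1 = proj₂ (absorb x S)
  absorbed-mult : ∀ c → InRow (x , y) c → suc (mult c (S1 ++ D)) ≡ mult c (S ++ D)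
  absorbed-mult c r rewrite mult-++ c S1 D | mult-++ c S D | Sp.absorbed∉rest c r
    | mult-strict≡1 c S S< (Sp.absorbed∈ c r) = refl

absorb-row-into-D : ∀ x S D → AllPairs _<_ S →
  AbsorbIncreasing x S (proj₁ (absorb x S)) (proj₂ (absorb x S)) →
  proj₁ (absorb (proj₁ (absorb x S)) D) ≡ suc (proj₁ (absorb x S)) →
  AbsorbDecreasing (proj₁ (absorb x S)) D (proj₂ (absorb (proj₁ (absorb x S)) D)) →
  AbsorbRow x S D (suc (proj₁ (absorb x S))) (proj₂ (absorb x S)) (proj₂ (absorb (proj₁ (absorb x S)) D))
absorb-row-into-D x S D S< sp ends-in-D sd = record
  { absorb≡ = trans (absorb-++ x S D) (cong (λ z → z , S1 ++ D') ends-in-D)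
  ; start≤end = ≤-trans Sp.start≤end (n≤1+n y)
  ; inner∈S = λ c a b → Sp.absorbed∈ c (a , ≤-pred b)
  ; absorbed∉S' = absorbed∉S'
  ; S'-mult = λ c r → Sp.rest-mult c (λ (a , b) → r (a , ≤-trans b (n≤1+n y)))
  ; absorbed-mult = absorbed-mult
  ; rest-mult = rest-mult
  ; S'-increasing = Sp.rest-increasing
  ; D'-decreasing = Sd.rest-decreasing
  ; S'-All = Sp.rest-All
  ; D'-All = Sd.rest-All
  ; halt = inj₂ (Sp.next∉ , s≤s Sp.start≤end) }
  where
  module Sp = AbsorbIncreasing sp
  module Sd = AbsorbDecreasing sd
  y = proj₁ (absorb x S)
  S1 = proj₂ (absorb x S)
  D' = proj₂ (absorb y D)
  absorbed∉S' : ∀ c → InRow (x , suc y) c → mult c S1 ≡ 0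
  absorbed∉S' c (a , b) with m≤n⇒m<n∨m≡n b
  ... | inj₁ c<y+1 = Sp.absorbed∉rest c (a , ≤-pred c<y+1)
  ... | inj₂ refl = trans (Sp.rest-mult (suc y) (λ (_ , q) → <-irrefl refl q)) Sp.next∉
  absorbed-mult : ∀ c → InRow (x , suc y) c → suc (mult c (S1 ++ D')) ≡ mult c (S ++ D)
  absorbed-mult c (a , b) with m≤n⇒m<n∨m≡n b
  ... | inj₁ c<y+1 rewrite mult-++ c S1 D' | mult-++ c S D | Sp.absorbed∉rest c (a , ≤-pred c<y+1)
          | mult-strict≡1 c S S< (Sp.absorbed∈ c (a , ≤-pred c<y+1))
          | Sd.rest-mult c (λ e → <-irrefl e c<y+1) = refl
  ... | inj₂ refl rewrite mult-++ (suc y) S1 D' | mult-++ (suc y) S D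
          | Sp.rest-mult (suc y) (λ (_ , q) → <-irrefl refl q) | Sp.next∉
          | Sd.next-absorbed = refl
  rest-mult : ∀ c → ¬ InRow (x , suc y) c → mult c (S1 ++ D') ≡ mult c (S ++ D)
  rest-mult c r rewrite mult-++ c S1 D' | mult-++ c S D
     | Sp.rest-mult c (λ (a , b) → r (a , ≤-trans b (n≤1+n y)))
     | Sd.rest-mult c (λ e → r (subst (x <_) (sym e) (s≤s Sp.start≤end) , ≤-reflexive e)) = refl

absorb-row : ∀ x S D → AllPairs _<_ S → AllPairs _≥_ D →
  Σ ℕ λ y → Σ (List ℕ) λ S' → Σ (List ℕ) λ D' → AbsorbRow x S D y S' D'
absorb-row x S D S< D≥ with absorb-increasing x S S< | mult (suc (proj₁ (absorb x S))) D ≟ 0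
... | sp | yes next∉D = _ , _ , _ , absorb-row-within-S x S D S< D≥ sp next∉D
... | sp | no next∈D with absorb-decreasing (proj₁ (absorb x S)) D D≥ (n≢0⇒n>0 next∈D)
...   | ends-in-D , sd = _ , _ , _ , absorb-row-into-D x S D S< sp ends-in-D sd

PairInRow : Row → ℕ → Set
PairInRow (a , g) j = a < j × suc j ≤ g

ind : ∀ {P : Set} → Dec P → ℕ
ind (yes _) = 1
ind (no _) = 0

colSize : List Row → ℕ → ℕ
colSize [] c = 0
colSize (r ∷ R) c = ind (inRow? r c) + colSize R c

colSize-∈ : ∀ r R c → InRow r c → colSize (r ∷ R) c ≡ suc (colSize R c)
colSize-∈ r R c p with inRow? r c
... | yes _ = refl
... | no ¬p = ⊥-elim (¬p p)

colSize-∉ : ∀ r R c → ¬ InRow r c → colSize (r ∷ R) c ≡ colSize R c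
colSize-∉ r R c ¬p with inRow? r c
... | yes p = ⊥-elim (¬p p)
... | no _ = refl

colSize-∷ : ∀ r R c → colSize R c ≤ colSize (r ∷ R) c
colSize-∷ r R c = m≤n+m (colSize R c) (ind (inRow? r c))

colSize>0⇒Any : ∀ R c → 0 < colSize R c → Any (λ r → InRow r c) R
colSize>0⇒Any (r ∷ R) c pos with inRow? r c
... | yes p = here p
... | no _ = there (colSize>0⇒Any R c pos)

Grown : List Row → Set
Grown = All (λ (a , g) → a ≤ g)

-- Condition (2) of an nc border strip, read row by row.
PairsTopmost : List Row → Set
PairsTopmost = AllPairs (λ r r' → ∀ j → InRow r j → PairInRow r' j → ⊥)

-- A row that did not grow blocks every later row from growing past it: the later row would
-- have to pass through the same length, and only the leftmost part of a given size can grow.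
EmptyRowsBlock : List Row → Set
EmptyRowsBlock = AllPairs (λ (a , g) (a' , g') → a ≡ g → a' ≤ g → g < g' → ⊥)

PairsIn : List ℕ → List Row → Set
PairsIn S = All (λ r → ∀ j → PairInRow r j → 0 < mult j S)

-- Every letter c of the increasing part is the left one of two adjacent boxes of some row, or
-- column c + 1 is empty; this keeps a row from absorbing a letter that belongs to a lower row.
LettersPlaced : List ℕ → List Row → Set
LettersPlaced S R = ∀ c → 0 < mult c S → Any (λ r → PairInRow r c) R ⊎ colSize R (suc c) ≡ 0

record RowDecomposition (S D xs ys : List ℕ) : Set₁ where
  field
    rows : List Row
    starts : map proj₁ rows ≡ xs
    ends : map proj₂ rows ≡ ys
    grown : Grown rows
    pairs-topmost : PairsTopmost rows
    pairs-in : PairsIn S rows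
    counts : ∀ c → mult c (S ++ D) ≡ colSize rows c

map≡just : ∀ {A B : Set} (f : A → B) (m : Maybe A) b → Maybe.map f m ≡ just b →
  Σ A λ a → (m ≡ just a) × (f a ≡ b)
map≡just f (just a) b refl = a , refl , refl

runRows-[] : ∀ s ys → runRows [] s ≡ just ys → s ≡ [] × ys ≡ []
runRows-[] [] .[] refl = refl , refl

runRows⇒decomposition : ∀ xs S D ys → AllPairs _<_ S → AllPairs _≥_ D →
  runRows xs (S ++ D) ≡ just ys → RowDecomposition S D xs ys
runRows⇒decomposition [] S D ys S< D≥ e with runRows-[] (S ++ D) ys e
... | S++D≡[] , refl rewrite ++-conicalˡ S D S++D≡[] | ++-conicalʳ S D S++D≡[] = record
  { rows = [] ; starts = refl ; ends = refl ; grown = [] ; pairs-topmost = [] ; pairs-in = [] ; counts = λ c → refl }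
runRows⇒decomposition (x ∷ xs) S D ys S< D≥ e with absorb-row x S D S< D≥
... | y , S' , D' , ar with map≡just (proj₁ (absorb x (S ++ D)) ∷_) (runRows xs (proj₂ (absorb x (S ++ D)))) ys e
... | ys' , e' , refl rewrite AbsorbRow.absorb≡ ar
  with runRows⇒decomposition xs S' D' ys' (AbsorbRow.S'-increasing ar) (AbsorbRow.D'-decreasing ar) e'
... | T = record
  { rows = (x , y) ∷ T.rows
  ; starts = cong (x ∷_) T.starts
  ; ends = cong (y ∷_) T.ends
  ; grown = AbsorbRow.start≤end ar ∷ T.grown
  ; pairs-topmost = All.map (λ f j inr pr → <-irrefl (sym (AbsorbRow.absorbed∉S' ar j inr)) (f j pr)) T.pairs-in
                    ∷ T.pairs-topmost
  ; pairs-in = (λ j (a , b) → AbsorbRow.inner∈S ar j a b) ∷ All.map (λ f j pr → S'⇒S j (f j pr)) T.pairs-in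
  ; counts = counts }
  where
  module T = RowDecomposition T
  S'⇒S : ∀ j → 0 < mult j S' → 0 < mult j S
  S'⇒S j pos with inRow? (x , y) j
  ... | yes p = ⊥-elim (<-irrefl (sym (AbsorbRow.absorbed∉S' ar j p)) pos)
  ... | no ¬p = subst (0 <_) (AbsorbRow.S'-mult ar j ¬p) pos
  counts : ∀ c → mult c (S ++ D) ≡ colSize ((x , y) ∷ T.rows) c
  counts c with inRow? (x , y) c
  ... | yes p = trans (sym (AbsorbRow.absorbed-mult ar c p)) (cong suc (T.counts c))
  ... | no ¬p = trans (sym (AbsorbRow.rest-mult ar c ¬p)) (T.counts c)

absorb-row-end : ∀ a g R S D y S' D' → AbsorbRow a S D y S' D' → a ≤ g →
  All (λ r' → ∀ j → InRow (a , g) j → PairInRow r' j → ⊥) R →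
  All (λ (a' , g') → a ≡ g → a' ≤ g → g < g' → ⊥) R →
  (∀ j → PairInRow (a , g) j → 0 < mult j S) → LettersPlaced S ((a , g) ∷ R) →
  (∀ c → mult c (S ++ D) ≡ colSize ((a , g) ∷ R) c) → y ≡ g
absorb-row-end a g R S D y S' D' ar a≤g topmost blocked pairs∈S placed counts with <-cmp y g
... | tri≈ _ y≡g _ = y≡g
... | tri< y<g _ _ with AbsorbRow.halt ar
...   | inj₁ y+1∉ = ⊥-elim (<-irrefl (trans (sym y+1∉) (counts (suc y)))
                 (subst (0 <_) (sym (colSize-∈ (a , g) R (suc y) (s≤s (AbsorbRow.start≤end ar) , y<g))) (s≤s z≤n)))
...   | inj₂ (y∉S , a<y) = ⊥-elim (<-irrefl (sym y∉S) (pairs∈S y (a<y , y<g)))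
absorb-row-end a g R S D y S' D' ar a≤g topmost blocked pairs∈S placed counts | tri> _ _ g<y
  with m≤n⇒m<n∨m≡n a≤g
... | inj₁ a<g with placed g (AbsorbRow.inner∈S ar g a<g g<y)
...   | inj₁ (here (_ , g+1≤g)) = ⊥-elim (<-irrefl refl g+1≤g)
...   | inj₁ (there pair) = ⊥-elim (All.lookupWith (λ f p → f g (a<g , ≤-refl) p) topmost pair)
...   | inj₂ g+1-empty = ⊥-elim (<-irrefl (sym g+1-empty) (subst (0 <_) (counts (suc g))
             (subst (0 <_) (AbsorbRow.absorbed-mult ar (suc g) (s≤s (<⇒≤ a<g) , g<y)) (s≤s z≤n))))
absorb-row-end a g R S D y S' D' ar a≤g topmost blocked pairs∈S placed counts | tri> _ _ g<y | inj₂ refl =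
  ⊥-elim (All.lookupWith (λ f (p , q) → f refl (≤-pred p) q) blocked (colSize>0⇒Any R (suc a) a+1-used))
  where
  a+1-used : 0 < colSize R (suc a)
  a+1-used = subst (0 <_) (trans (counts (suc a)) (colSize-∉ (a , a) R (suc a) (λ (_ , q) → <-irrefl refl q)))
               (subst (0 <_) (AbsorbRow.absorbed-mult ar (suc a) (≤-refl , g<y)) (s≤s z≤n))

PairsIn-rest : ∀ r R S S' → (∀ j → ¬ InRow r j → mult j S' ≡ mult j S) →
  All (λ r' → ∀ j → InRow r j → PairInRow r' j → ⊥) R → PairsIn S R → PairsIn S' R
PairsIn-rest r [] S S' S'-mult [] [] = []
PairsIn-rest r (r' ∷ R) S S' S'-mult (n ∷ ns) (p ∷ ps) =
  (λ j pr → subst (0 <_) (sym (S'-mult j (λ inr → n j inr pr))) (p j pr)) ∷ PairsIn-rest r R S S' S'-mult ns ps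

decomposition⇒runRows : ∀ R S D → AllPairs _<_ S → AllPairs _≥_ D → Grown R → PairsTopmost R →
  EmptyRowsBlock R → PairsIn S R → LettersPlaced S R → (∀ c → mult c (S ++ D) ≡ colSize R c) →
  runRows (map proj₁ R) (S ++ D) ≡ just (map proj₂ R)
decomposition⇒runRows [] S D _ _ _ _ _ _ _ counts rewrite mult≡0⇒[] (S ++ D) counts = refl
decomposition⇒runRows ((a , g) ∷ R) S D S< D≥ (a≤g ∷ grown) (topmost ∷ topmost') (blocked ∷ blocked')
  (pairs∈S ∷ pairs-in) placed counts with absorb-row a S D S< D≥
... | y , S' , D' , ar with absorb-row-end a g R S D y S' D' ar a≤g topmost blocked pairs∈S placed counts
... | refl rewrite AbsorbRow.absorb≡ ar =
  cong (Maybe.map (y ∷_)) (decomposition⇒runRows R S' D' (AbsorbRow.S'-increasing ar) (AbsorbRow.D'-decreasing ar)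
     grown topmost' blocked' (PairsIn-rest (a , y) R S S' (AbsorbRow.S'-mult ar) topmost pairs-in) placed' counts')
  where
  placed' : LettersPlaced S' R
  placed' c pos with inRow? (a , y) c
  ... | yes p = ⊥-elim (<-irrefl (sym (AbsorbRow.absorbed∉S' ar c p)) pos)
  ... | no ¬p with placed c (subst (0 <_) (AbsorbRow.S'-mult ar c ¬p) pos)
  ...   | inj₁ (here (p , q)) = ⊥-elim (¬p (p , ≤-trans (n≤1+n c) q))
  ...   | inj₁ (there pair) = inj₁ pair
  ...   | inj₂ empty = inj₂ (n≤0⇒n≡0 (subst (colSize R (suc c) ≤_) empty (colSize-∷ (a , y) R (suc c))))
  counts' : ∀ c → mult c (S' ++ D') ≡ colSize R c
  counts' c with inRow? (a , y) c
  ... | yes p = suc-injective (trans (AbsorbRow.absorbed-mult ar c p) (trans (counts c) (colSize-∈ (a , y) R c p)))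
  ... | no ¬p = trans (AbsorbRow.rest-mult ar c ¬p) (trans (counts c) (colSize-∉ (a , y) R c ¬p))

-- Skew shapes as lists of rows

entry : ∀ {A : Set} → A → List A → ℕ → A
entry d [] i = d
entry d (x ∷ xs) zero = d
entry d (x ∷ xs) (suc zero) = x
entry d (x ∷ xs) (suc (suc i)) = entry d xs (suc i)

entry-zip : ∀ (xs ys : List ℕ) → length xs ≡ length ys →
  ∀ i → entry (0 , 0) (zip xs ys) i ≡ (part xs i , part ys i)
entry-zip [] [] e i = refl
entry-zip (x ∷ xs) (y ∷ ys) e zero = refl
entry-zip (x ∷ xs) (y ∷ ys) e (suc zero) = refl
entry-zip (x ∷ xs) (y ∷ ys) e (suc (suc i)) = entry-zip xs ys (suc-injective e) (suc i)

module _ {A : Set} (d : A) where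

  Index : List A → ℕ → Set
  Index xs i = 1 ≤ i × i ≤ length xs

  Any⇒entry : ∀ {P : A → Set} xs → Any P xs → Σ ℕ λ i → Index xs i × P (entry d xs i)
  Any⇒entry (x ∷ xs) (here p) = 1 , (s≤s z≤n , s≤s z≤n) , p
  Any⇒entry (x ∷ xs) (there a) with Any⇒entry xs a
  ... | suc k , (_ , k≤) , p = suc (suc k) , (s≤s z≤n , s≤s k≤) , p

  entry⇒Any : ∀ {P : A → Set} xs i → Index xs i → P (entry d xs i) → Any P xs
  entry⇒Any (x ∷ xs) (suc zero) _ p = here p
  entry⇒Any (x ∷ xs) (suc (suc k)) (_ , s≤s k≤) p = there (entry⇒Any xs (suc k) (s≤s z≤n , k≤) p)

  All⇒entry : ∀ {P : A → Set} xs → All P xs → ∀ i → Index xs i → P (entry d xs i)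
  All⇒entry (x ∷ xs) (p ∷ ps) (suc zero) _ = p
  All⇒entry (x ∷ xs) (p ∷ ps) (suc (suc k)) (_ , s≤s k≤) = All⇒entry xs ps (suc k) (s≤s z≤n , k≤)

  entry⇒All : ∀ {P : A → Set} xs → (∀ i → Index xs i → P (entry d xs i)) → All P xs
  entry⇒All [] f = []
  entry⇒All (x ∷ xs) f =
    f 1 (s≤s z≤n , s≤s z≤n) ∷ entry⇒All xs (λ { (suc k) (_ , k≤) → f (suc (suc k)) (s≤s z≤n , s≤s k≤) })

  AllPairs⇒entries : ∀ {R : A → A → Set} xs → AllPairs R xs →
    ∀ i i' → 1 ≤ i → i < i' → i' ≤ length xs → R (entry d xs i) (entry d xs i')
  AllPairs⇒entries (x ∷ xs) (a ∷ ap) (suc zero) (suc (suc k)) _ _ (s≤s k≤) = All⇒entry xs a (suc k) (s≤s z≤n , k≤)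
  AllPairs⇒entries (x ∷ xs) (a ∷ ap) (suc zero) (suc zero) _ (s≤s ()) _
  AllPairs⇒entries (x ∷ xs) (a ∷ ap) (suc (suc k)) (suc (suc k')) _ (s≤s lt) (s≤s k'≤) =
    AllPairs⇒entries xs ap (suc k) (suc k') (s≤s z≤n) lt k'≤

  entries⇒AllPairs : ∀ {R : A → A → Set} xs →
    (∀ i i' → 1 ≤ i → i < i' → i' ≤ length xs → R (entry d xs i) (entry d xs i')) → AllPairs R xs
  entries⇒AllPairs [] f = []
  entries⇒AllPairs (x ∷ xs) f =
    entry⇒All xs (λ { (suc k) (_ , k≤) → f 1 (suc (suc k)) (s≤s z≤n) (s≤s (s≤s z≤n)) (s≤s k≤) })
    ∷ entries⇒AllPairs xs (λ { (suc k) (suc k') _ lt k'≤ → f (suc (suc k)) (suc (suc k')) (s≤s z≤n) (s≤s lt) (s≤s k'≤) })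

part-0 : ∀ xs → part xs 0 ≡ 0
part-0 [] = refl
part-0 (x ∷ xs) = refl

part-padding : ∀ d α i → i ≤ d → part (replicate d 0 ++ α) i ≡ 0
part-padding zero α zero z≤n = part-0 α
part-padding (suc d) α zero _ = refl
part-padding (suc d) α (suc zero) _ = refl
part-padding (suc d) α (suc (suc k)) (s≤s le) = part-padding d α (suc k) le

part-padded : ∀ d α k → part (replicate d 0 ++ α) (suc k + d) ≡ part α (suc k)
part-padded zero α k rewrite +-identityʳ k = refl
part-padded (suc d) α k rewrite +-suc k d = part-padded d α k

-- α bottom-aligned against β: the rows of β//α are (pad α β)ᵢ < j ≤ βᵢ.
pad : List ℕ → List ℕ → List ℕ
pad α β = replicate (length β ∸ length α) 0 ++ α

skewRows : List ℕ → List ℕ → List Row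
skewRows α β = zip (pad α β) β

length-pad : ∀ α β → length α ≤ length β → length (pad α β) ≡ length β
length-pad α β le rewrite length-++ (replicate (length β ∸ length α) 0) {α}
  | length-replicate (length β ∸ length α) {0} = m∸n+n≡m le

length-skewRows : ∀ α β → length α ≤ length β → length (skewRows α β) ≡ length β
length-skewRows α β le = trans (length-zipWith _,_ (pad α β) β)
  (trans (cong (_⊓ length β) (length-pad α β le)) (⊓-idem (length β)))

entry-skewRows : ∀ α β → length α ≤ length β → ∀ i → entry (0 , 0) (skewRows α β) i ≡ (part (pad α β) i , part β i)
entry-skewRows α β le i = entry-zip (pad α β) β (length-pad α β le) i

InSkew⇒InRow : ∀ α β → length α ≤ length β → ∀ i j → InSkew β α i j →
  Index (0 , 0) (skewRows α β) i × InRow (entry (0 , 0) (skewRows α β) i) j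
InSkew⇒InRow α β le i j ((i≥1 , i≤ , j≥1 , j≤) , ∉α) rewrite entry-skewRows α β le i =
  (i≥1 , subst (i ≤_) (sym (length-skewRows α β le)) i≤) , padded<j , j≤
  where
  d = length β ∸ length α
  padded<j : part (pad α β) i < j
  padded<j with i ≤? d
  ... | yes i≤d rewrite part-padding d α i i≤d = j≥1
  ... | no i≰d with m≤n⇒∃[o]m+o≡n (≰⇒> i≰d)
  ...   | k , e with part α (suc k) <? j
  ...     | yes p = subst (_< j) (sym (trans (cong (part (pad α β)) i≡) (part-padded d α k))) p
    where i≡ = trans (sym e) (cong suc (+-comm d k))
  ...     | no ¬p = ⊥-elim (∉α (suc k , i≡ , s≤s z≤n , k+1≤ , j≥1 , ≮⇒≥ ¬p))
    where
    i≡ = trans (sym e) (cong suc (+-comm d k))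
    k+1≤ : suc k ≤ length α
    k+1≤ = +-cancelʳ-≤ d (suc k) (length α) (subst (_≤ length α + d) i≡
             (subst (i ≤_) (sym (m+[n∸m]≡n le)) i≤))

InRow⇒InSkew : ∀ α β → length α ≤ length β → ∀ i j →
  Index (0 , 0) (skewRows α β) i → InRow (entry (0 , 0) (skewRows α β) i) j → InSkew β α i j
InRow⇒InSkew α β le i j (i≥1 , i≤) inr rewrite entry-skewRows α β le i =
  (i≥1 , subst (i ≤_) (length-skewRows α β le) i≤ , ≤-trans (s≤s z≤n) (proj₁ inr) , proj₂ inr) , ∉α
  where
  d = length β ∸ length α
  ∉α : ¬ (Σ ℕ λ i' → (i ≡ i' + d) × InDiagram α i' j)
  ∉α (suc k , e , _ , _ , _ , j≤) = <-irrefl refl (<-≤-trans (proj₁ inr)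
    (subst (j ≤_) (sym (trans (cong (part (pad α β)) e) (part-padded d α k))) j≤))

InCol : ℕ → Row → Set
InCol j r = InRow r j

Col1Rule : Row → Row → Set
Col1Rule r r' = InRow r 1 → InRow r 2 → InRow r' 1 → ⊥

ColjRule : ℕ → Row → Row → Set
ColjRule j r r' = InRow r j → InRow r' j → InRow r' (suc j) → ⊥

ColumnInterval : List Row → Set
ColumnInterval R = ∀ a b c → Any (InCol a) R → Any (InCol c) R → a ≤ b → b ≤ c → Any (InCol b) R

-- The nc border strip conditions, with "i' ≤ i" turned into the order of the row list.
NCRows : List Row → Set
NCRows R = ColumnInterval R × AllPairs Col1Rule R × (∀ j → 2 ≤ j → AllPairs (ColjRule j) R)

InSupport⇒Any : ∀ α β → length α ≤ length β → ∀ j → InSupport β α j → Any (InCol j) (skewRows α β)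
InSupport⇒Any α β le j (i , sk) with InSkew⇒InRow α β le i j sk
... | idx , inr = entry⇒Any (0 , 0) (skewRows α β) i idx inr

Any⇒InSupport : ∀ α β → length α ≤ length β → ∀ j → Any (InCol j) (skewRows α β) → InSupport β α j
Any⇒InSupport α β le j an with Any⇒entry (0 , 0) (skewRows α β) an
... | i , idx , inr = i , InRow⇒InSkew α β le i j idx inr

NCBorderStrip⇒NCRows : ∀ α β → length α ≤ length β → IsNCBorderStrip β α → NCRows (skewRows α β)
NCBorderStrip⇒NCRows α β le (interval , col1 , colj) =
  (λ a b c pa pc ab bc → InSupport⇒Any α β le b
     (interval a b c (Any⇒InSupport α β le a pa) (Any⇒InSupport α β le c pc) ab bc)) ,
  entries⇒AllPairs (0 , 0) R (λ i i' i≥1 i<i' i'≤ r1 r2 r'1 →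
     <⇒≱ i<i' (col1 i (upper i≥1 i<i' i'≤ r1) (upper i≥1 i<i' i'≤ r2) i' (lower i≥1 i<i' i'≤ r'1))) ,
  (λ j j≥2 → entries⇒AllPairs (0 , 0) R (λ i i' i≥1 i<i' i'≤ rj r'j r'j1 →
     <⇒≱ i<i' (colj i' j j≥2 (lower i≥1 i<i' i'≤ r'j) (lower i≥1 i<i' i'≤ r'j1) i (upper i≥1 i<i' i'≤ rj))))
  where
  R = skewRows α β
  upper : ∀ {i i' j} → 1 ≤ i → i < i' → i' ≤ length R → InRow (entry (0 , 0) R i) j → InSkew β α i j
  upper i≥1 i<i' i'≤ inr = InRow⇒InSkew α β le _ _ (i≥1 , ≤-trans (<⇒≤ i<i') i'≤) inr
  lower : ∀ {i i' j} → 1 ≤ i → i < i' → i' ≤ length R → InRow (entry (0 , 0) R i') j → InSkew β α i' j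
  lower i≥1 i<i' i'≤ inr = InRow⇒InSkew α β le _ _ (≤-trans i≥1 (<⇒≤ i<i') , i'≤) inr

NCRows⇒NCBorderStrip : ∀ α β → length α ≤ length β → NCRows (skewRows α β) → IsNCBorderStrip β α
NCRows⇒NCBorderStrip α β le (interval , col1 , colj) =
  (λ a b c pa pc ab bc → Any⇒InSupport α β le b
     (interval a b c (InSupport⇒Any α β le a pa) (InSupport⇒Any α β le c pc) ab bc)) ,
  (λ i s1 s2 i' s'1 → ≮⇒≥ (λ i<i' → AllPairs⇒entries (0 , 0) R col1 i i' (row≥1 s1) i<i' (row≤ s'1)
       (inRow s1) (inRow s2) (inRow s'1))) ,
  (λ i j j≥2 sj sj1 i' s'j → ≮⇒≥ (λ i'<i → AllPairs⇒entries (0 , 0) R (colj j j≥2) i' i (row≥1 s'j) i'<i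
       (row≤ sj) (inRow s'j) (inRow sj) (inRow sj1)))
  where
  R = skewRows α β
  row≥1 : ∀ {i j} → InSkew β α i j → 1 ≤ i
  row≥1 s = proj₁ (proj₁ (InSkew⇒InRow α β le _ _ s))
  row≤ : ∀ {i j} → InSkew β α i j → i ≤ length R
  row≤ s = proj₂ (proj₁ (InSkew⇒InRow α β le _ _ s))
  inRow : ∀ {i j} → InSkew β α i j → InRow (entry (0 , 0) R i) j
  inRow s = proj₂ (InSkew⇒InRow α β le _ _ s)

-- Chains of covers

-- Along a chain α <c δ the parts of α grow in place at the bottom of δ, and new parts appear on top.
record Reachable (α δ : List ℕ) : Set where
  constructor reachable
  field
    new γ : List ℕ
    δ≡ : δ ≡ new ++ γ
    length-γ : length γ ≡ length α
    new-positive : All (0 <_) new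
    grown : Grown (zip α γ)
    empty-rows-block : EmptyRowsBlock (zip α γ)

∷-in-++ : ∀ (pre : List A) x post P γ → pre ++ x ∷ post ≡ P ++ γ →
  (Σ (List A) λ pre' → (pre ≡ P ++ pre') × (γ ≡ pre' ++ x ∷ post)) ⊎
  (Σ (List A) λ P' → (P ≡ pre ++ x ∷ P') × (post ≡ P' ++ γ))
∷-in-++ pre x post [] γ e = inj₁ (pre , refl , sym e)
∷-in-++ [] x post (p ∷ P) γ refl = inj₂ (P , refl , refl)
∷-in-++ (q ∷ pre) x post (p ∷ P) γ e with ∷-injective e
... | refl , e' with ∷-in-++ pre x post P γ e'
... | inj₁ (pre' , a , b) = inj₁ (pre' , cong (q ∷_) a , b)
... | inj₂ (P' , a , b) = inj₂ (P' , cong (q ∷_) a , b)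

split-like : ∀ (α : List A) (p : List B) x q → length α ≡ length (p ++ x ∷ q) →
  Σ (List A) λ αa → Σ A λ a → Σ (List A) λ αb →
    (α ≡ αa ++ a ∷ αb) × (length αa ≡ length p) × (length αb ≡ length q)
split-like (a ∷ α) [] x q e = [] , a , α , refl , refl , suc-injective e
split-like (a' ∷ α) (y ∷ p) x q e with split-like α p x q (suc-injective e)
... | αa , a , αb , refl , l1 , l2 = a' ∷ αa , a , αb , refl , cong suc l1 , l2

zip-++-∷ : ∀ (αa : List A) a αb (p : List B) x q → length αa ≡ length p →
  zip (αa ++ a ∷ αb) (p ++ x ∷ q) ≡ zip αa p ++ (a , x) ∷ zip αb q
zip-++-∷ [] a αb [] x q e = refl
zip-++-∷ (a' ∷ αa) a αb (y ∷ p) x q e = cong ((a' , y) ∷_) (zip-++-∷ αa a αb p x q (suc-injective e))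

All-replace : ∀ {P : A → Set} xs {x y} ys → All P (xs ++ x ∷ ys) → P y → All P (xs ++ y ∷ ys)
All-replace [] ys (_ ∷ ps) p = p ∷ ps
All-replace (z ∷ xs) ys (q ∷ ps) p = q ∷ All-replace xs ys ps p

All-middle : ∀ {P : A → Set} xs {x} ys → All P (xs ++ x ∷ ys) → P x
All-middle [] ys (p ∷ _) = p
All-middle (z ∷ xs) ys (_ ∷ ps) = All-middle xs ys ps

All-zip-proj₂ : ∀ {Q : B → Set} (αa : List A) (p : List B) → All Q p → All (λ z → Q (proj₂ z)) (zip αa p)
All-zip-proj₂ [] p _ = []
All-zip-proj₂ (a ∷ αa) [] [] = []
All-zip-proj₂ (a ∷ αa) (y ∷ p) (q ∷ qs) = q ∷ All-zip-proj₂ αa p qs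

AllPairs-replace : ∀ {R : A → A → Set} xs {x y} ys → AllPairs R (xs ++ x ∷ ys) →
  All (λ z → R z x → R z y) xs → All (R y) ys → AllPairs R (xs ++ y ∷ ys)
AllPairs-replace [] ys (_ ∷ ap) [] h = h ∷ ap
AllPairs-replace (z ∷ xs) ys (a ∷ ap) (f ∷ fs) h =
  All-replace xs ys a (f (All-middle xs ys a)) ∷ AllPairs-replace xs ys ap fs h

length-replace : ∀ (p : List A) x y q → length (p ++ x ∷ q) ≡ length (p ++ y ∷ q)
length-replace [] x y q = refl
length-replace (z ∷ p) x y q = cong suc (length-replace p x y q)

reachable-⋖c : ∀ α δ δ' → Reachable α δ → δ ⋖c δ' → Reachable α δ'
reachable-⋖c α δ .(1 ∷ δ) (reachable P γ e lγ pp mo re) (prepend1 .δ) =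
  reachable (1 ∷ P) γ (cong (1 ∷_) e) lγ (s≤s z≤n ∷ pp) mo re
reachable-⋖c α .(pre ++ x ∷ post) .(pre ++ suc x ∷ post) (reachable P γ e lγ pp mo re) (increase pre x post pre≢x)
  with ∷-in-++ pre x post P γ e
... | inj₂ (P' , refl , refl) =
  reachable (pre ++ suc x ∷ P') γ (sym (++-assoc pre (suc x ∷ P') γ)) lγ (All-replace pre P' pp (s≤s z≤n)) mo re
... | inj₁ (pre' , refl , refl) with split-like α pre' x post (sym lγ)
... | αa , a , αb , refl , l1 , l2 =
  reachable P (pre' ++ suc x ∷ post) (++-assoc P pre' _) (trans (sym (length-replace pre' x (suc x) post)) lγ) pp
    grown empty-rows-block
  where
  Za = zip αa pre'
  Zb = zip αb post
  zip≡ = zip-++-∷ αa a αb pre' x post l1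
  zip'≡ = zip-++-∷ αa a αb pre' (suc x) post l1
  grown-before : Grown (Za ++ (a , x) ∷ Zb)
  grown-before = subst Grown zip≡ mo
  a≤x : a ≤ x
  a≤x = All-middle Za Zb grown-before
  grown : Grown (zip (αa ++ a ∷ αb) (pre' ++ suc x ∷ post))
  grown = subst Grown (sym zip'≡) (All-replace Za Zb grown-before (≤-trans a≤x (n≤1+n x)))
  -- A row above has length ≠ x, so the new length x + 1 exceeds it only if x already did.
  empty-rows-block : EmptyRowsBlock (zip (αa ++ a ∷ αb) (pre' ++ suc x ∷ post))
  empty-rows-block = subst EmptyRowsBlock (sym zip'≡) (AllPairs-replace Za Zb (subst EmptyRowsBlock zip≡ re)
    (All.map (λ ne old e1 e2 e3 → old e1 e2 (≤∧≢⇒< (≤-pred e3) ne)) (All-zip-proj₂ αa pre' (Allₚ.++⁻ʳ P pre≢x)))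
    (All.universal (λ _ e _ _ → <-irrefl e (s≤s a≤x)) Zb))

reachable-refl : ∀ α → Reachable α α
reachable-refl α = reachable [] α refl refl [] (grown α) (empty-rows-block α)
  where
  grown : ∀ α → Grown (zip α α)
  grown [] = []
  grown (x ∷ α) = ≤-refl ∷ grown α
  empty-rows-block : ∀ α → EmptyRowsBlock (zip α α)
  empty-rows-block [] = []
  empty-rows-block (x ∷ α) = diagonal α ∷ empty-rows-block α
    where
    diagonal : ∀ α → All (λ (a' , g') → x ≡ x → a' ≤ x → x < g' → ⊥) (zip α α)
    diagonal [] = []
    diagonal (y ∷ α) = (λ _ p q → <-irrefl refl (≤-<-trans p q)) ∷ diagonal α

reachable-<c : ∀ α δ → Reachable α δ → ∀ β → δ <c β → Reachable α β
reachable-<c α δ r β TC.[ st ] = reachable-⋖c α δ β r st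
reachable-<c α δ r β (st TC.∷ ch) = reachable-<c α _ (reachable-⋖c α δ _ r st) β ch

colSize-++ : ∀ (A B : List Row) c → colSize (A ++ B) c ≡ colSize A c + colSize B c
colSize-++ [] B c = refl
colSize-++ (r ∷ A) B c =
  trans (cong (ind (inRow? r c) +_) (colSize-++ A B c)) (sym (+-assoc (ind (inRow? r c)) (colSize A c) (colSize B c)))

Any⇒colSize>0 : ∀ R c → Any (InCol c) R → 0 < colSize R c
Any⇒colSize>0 (r ∷ R) c (here p) rewrite colSize-∈ r R c p = s≤s z≤n
Any⇒colSize>0 (r ∷ R) c (there a) = ≤-trans (Any⇒colSize>0 R c a) (colSize-∷ r R c)

¬Any⇒colSize≡0 : ∀ R c → ¬ Any (InCol c) R → colSize R c ≡ 0
¬Any⇒colSize≡0 R c ¬a = n≤0⇒n≡0 (≮⇒≥ (λ pos → ¬a (colSize>0⇒Any R c pos)))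

module _ {w : List ℕ} {R : List Row} (counts : ∀ c → mult c w ≡ colSize R c) where

  ∈⇒InCol : ∀ c → c ∈ w → Any (InCol c) R
  ∈⇒InCol c c∈w = colSize>0⇒Any R c (subst (0 <_) (counts c) (∈⇒mult>0 c w c∈w))

  InCol⇒∈ : ∀ c → Any (InCol c) R → c ∈ w
  InCol⇒∈ c a = mult>0⇒∈ c w (subst (0 <_) (sym (counts c)) (Any⇒colSize>0 R c a))

  connected⇒interval : IsConnected w → ColumnInterval R
  connected⇒interval conn a b c pa pc a≤b b≤c = ∈⇒InCol b (conn a b c (InCol⇒∈ a pa) (InCol⇒∈ c pc) a≤b b≤c)

  interval⇒connected : ColumnInterval R → IsConnected w
  interval⇒connected interval a b c a∈w c∈w a≤b b≤c =
    InCol⇒∈ b (interval a b c (∈⇒InCol a a∈w) (∈⇒InCol c c∈w) a≤b b≤c)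

oneRows : ℕ → List Row
oneRows k = replicate k (0 , 1)

colSize-oneRows : ∀ k c → colSize (oneRows k) c ≡ mult c (replicate k 1)
colSize-oneRows zero c = refl
colSize-oneRows (suc k) c with 1 ≟ c
... | yes refl rewrite mult-≡ 1 (replicate k 1) | colSize-∈ (0 , 1) (oneRows k) 1 (s≤s z≤n , s≤s z≤n) =
  cong suc (colSize-oneRows k 1)
... | no 1≢c rewrite mult-≢ c 1 (replicate k 1) 1≢c =
  trans (colSize-∉ (0 , 1) (oneRows k) c (λ { (s≤s z≤n , s≤s z≤n) → 1≢c refl })) (colSize-oneRows k c)

InCol-oneRows : ∀ k c → Any (InCol c) (oneRows k) → c ≡ 1
InCol-oneRows (suc k) c (here (s≤s z≤n , s≤s z≤n)) = refl
InCol-oneRows (suc k) c (there a) = InCol-oneRows k c a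

mult-stacked : ∀ s k R → (∀ c → mult c s ≡ colSize R c) →
  ∀ c → mult c (s ++ replicate k 1) ≡ colSize (oneRows k ++ R) c
mult-stacked s k R counts c = begin
  mult c (s ++ replicate k 1)               ≡⟨ mult-++ c s (replicate k 1) ⟩
  mult c s + mult c (replicate k 1)         ≡⟨ cong₂ _+_ (counts c) (sym (colSize-oneRows k c)) ⟩
  colSize R c + colSize (oneRows k) c       ≡⟨ +-comm (colSize R c) _ ⟩
  colSize (oneRows k) c + colSize R c       ≡⟨ colSize-++ (oneRows k) R c ⟨
  colSize (oneRows k ++ R) c                ∎
  where open ≡-Reasoning

-- The letter 1 puts a new row of length 1 on top.  When it leads the increasing part of a
-- word, we put a row of length 0 on top in advance instead, which then absorbs the 1.
data Lead : Set where
  none one : Lead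

leadRow : Lead → List ℕ
leadRow none = []
leadRow one = [ 0 ]

LeadStream : Lead → List ℕ → Set
LeadStream none s = All (2 ≤_) s
LeadStream one s = Σ (List ℕ) λ s' → (s ≡ 1 ∷ s') × All (2 ≤_) s'

run≡runRows-lead : ∀ o s α → LeadStream o s → run s α ≡ runRows (leadRow o ++ α) s
run≡runRows-lead none s α ok = run≡runRows α s ok
run≡runRows-lead one .(1 ∷ s') α (s' , refl , ok) = run≡runRows (1 ∷ α) s' ok

run-stream : ∀ o s k α → LeadStream o s →
  run (s ++ replicate k 1) α ≡ Maybe.map (replicate k 1 ++_) (runRows (leadRow o ++ α) s)
run-stream o s k α ok rewrite run-++ s (replicate k 1) α | run≡runRows-lead o s α ok
  with runRows (leadRow o ++ α) s
... | nothing = refl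
... | just ys = run-ones k ys

run-stream⇒rows : ∀ o s k α β → LeadStream o s → run (s ++ replicate k 1) α ≡ just β →
  Σ (List ℕ) λ ys → runRows (leadRow o ++ α) s ≡ just ys × β ≡ replicate k 1 ++ ys
run-stream⇒rows o s k α β ok e
  with map≡just (replicate k 1 ++_) (runRows (leadRow o ++ α) s) β (trans (sym (run-stream o s k α ok)) e)
... | ys , runRows≡ , refl = ys , runRows≡ , refl

replicate-+ : ∀ m n (x : A) → replicate (m + n) x ≡ replicate m x ++ replicate n x
replicate-+ zero n x = refl
replicate-+ (suc m) n x = cong (x ∷_) (replicate-+ m n x)

leadRow≡replicate : ∀ o → leadRow o ≡ replicate (length (leadRow o)) 0
leadRow≡replicate none = refl
leadRow≡replicate one = refl

zip-++ : ∀ (xs : List A) (ys : List B) {xs' ys'} → length xs ≡ length ys →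
  zip (xs ++ xs') (ys ++ ys') ≡ zip xs ys ++ zip xs' ys'
zip-++ [] [] e = refl
zip-++ (x ∷ xs) (y ∷ ys) e = cong ((x , y) ∷_) (zip-++ xs ys (suc-injective e))

skewRows-stacked : ∀ k o α ys → length ys ≡ length (leadRow o ++ α) →
  skewRows α (replicate k 1 ++ ys) ≡ oneRows k ++ zip (leadRow o ++ α) ys
skewRows-stacked k o α ys len = begin
  zip (replicate (length β ∸ length α) 0 ++ α) β         ≡⟨ cong (λ d → zip (replicate d 0 ++ α) β) padding ⟩
  zip (replicate (k + length (leadRow o)) 0 ++ α) β      ≡⟨ cong (λ xs → zip xs β) stacked ⟩
  zip (replicate k 0 ++ leadRow o ++ α) β                ≡⟨ zip-++ (replicate k 0) (replicate k 1)
                                                             (trans (length-replicate k) (sym (length-replicate k))) ⟩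
  zip (replicate k 0) (replicate k 1) ++ zip (leadRow o ++ α) ys
                                                         ≡⟨ cong (_++ _) (zipWith-replicate k _,_ 0 1) ⟩
  oneRows k ++ zip (leadRow o ++ α) ys                   ∎
  where
  open ≡-Reasoning
  β = replicate k 1 ++ ys
  padding : length β ∸ length α ≡ k + length (leadRow o)
  padding = begin
    length β ∸ length α                                  ≡⟨ cong (_∸ length α) (length-++ (replicate k 1)) ⟩
    (length (replicate k 1) + length ys) ∸ length α      ≡⟨ cong (λ m → (m + length ys) ∸ length α) (length-replicate k) ⟩
    (k + length ys) ∸ length α                           ≡⟨ cong (λ m → (k + m) ∸ length α) (trans len (length-++ (leadRow o))) ⟩
    (k + (length (leadRow o) + length α)) ∸ length α     ≡⟨ cong (_∸ length α) (+-assoc k _ (length α)) ⟨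
    (k + length (leadRow o) + length α) ∸ length α       ≡⟨ m+n∸n≡m _ (length α) ⟩
    k + length (leadRow o)                               ∎
  stacked : replicate (k + length (leadRow o)) 0 ++ α ≡ replicate k 0 ++ leadRow o ++ α
  stacked = begin
    replicate (k + length (leadRow o)) 0 ++ α                  ≡⟨ cong (_++ α) (replicate-+ k _ 0) ⟩
    (replicate k 0 ++ replicate (length (leadRow o)) 0) ++ α   ≡⟨ ++-assoc (replicate k 0) _ α ⟩
    replicate k 0 ++ replicate (length (leadRow o)) 0 ++ α     ≡⟨ cong (λ xs → replicate k 0 ++ xs ++ α) (leadRow≡replicate o) ⟨
    replicate k 0 ++ leadRow o ++ α                            ∎

length-≤-stacked : ∀ k o α ys → length ys ≡ length (leadRow o ++ α) → length α ≤ length (replicate k 1 ++ ys)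
length-≤-stacked k o α ys len = begin
  length α                            ≤⟨ m≤n+m (length α) (length (leadRow o)) ⟩
  length (leadRow o) + length α       ≡⟨ trans len (length-++ (leadRow o)) ⟨
  length ys                           ≤⟨ m≤n+m (length ys) (length (replicate k 1)) ⟩
  length (replicate k 1) + length ys  ≡⟨ length-++ (replicate k 1) ⟨
  length (replicate k 1 ++ ys)        ∎
  where open ≤-Reasoning

map-proj₁-zip : ∀ (xs : List A) (ys : List B) → length xs ≡ length ys → map proj₁ (zip xs ys) ≡ xs
map-proj₁-zip [] [] e = refl
map-proj₁-zip (x ∷ xs) (y ∷ ys) e = cong (x ∷_) (map-proj₁-zip xs ys (suc-injective e))

map-proj₂-zip : ∀ (xs : List A) (ys : List B) → length xs ≡ length ys → map proj₂ (zip xs ys) ≡ ys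
map-proj₂-zip [] [] e = refl
map-proj₂-zip (x ∷ xs) (y ∷ ys) e = cong (y ∷_) (map-proj₂-zip xs ys (suc-injective e))

zip-map-proj : ∀ (R : List (A × B)) → zip (map proj₁ R) (map proj₂ R) ≡ R
zip-map-proj [] = refl
zip-map-proj (r ∷ R) = cong (r ∷_) (zip-map-proj R)

All-zip-proj₁ : ∀ {P : A → Set} (xs : List A) (ys : List B) → All P xs → All (λ z → P (proj₁ z)) (zip xs ys)
All-zip-proj₁ [] ys [] = []
All-zip-proj₁ (x ∷ xs) [] _ = []
All-zip-proj₁ (x ∷ xs) (y ∷ ys) (p ∷ ps) = p ∷ All-zip-proj₁ xs ys ps

¬InCol1 : ∀ {r : Row} → 0 < proj₁ r → ¬ InRow r 1
¬InCol1 {a , g} (s≤s z≤n) (s≤s () , _)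

Col1Rule-rows : ∀ R → All (λ r → 0 < proj₁ r) R → AllPairs Col1Rule R
Col1Rule-rows [] [] = []
Col1Rule-rows (r ∷ R) (_ ∷ ps) = All.map (λ p _ _ → ¬InCol1 p) ps ∷ Col1Rule-rows R ps

Col1Rule-lead : ∀ o α ys → All (0 <_) α → AllPairs Col1Rule (zip (leadRow o ++ α) ys)
Col1Rule-lead none α ys α>0 = Col1Rule-rows (zip α ys) (All-zip-proj₁ α ys α>0)
Col1Rule-lead one α [] α>0 = []
Col1Rule-lead one α (y ∷ ys) α>0 =
  All.map (λ p _ _ → ¬InCol1 p) (All-zip-proj₁ α ys α>0) ∷ Col1Rule-rows (zip α ys) (All-zip-proj₁ α ys α>0)

ColjRule-topmost : ∀ j R → PairsTopmost R → AllPairs (ColjRule j) R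
ColjRule-topmost j R topmost = AllPairs.map (λ f a b c → f j a (proj₁ b , proj₂ c)) topmost

AllPairs-++-universal : ∀ {R : A → A → Set} (xs ys : List A) → All (λ x → ∀ y → R x y) xs →
  AllPairs R ys → AllPairs R (xs ++ ys)
AllPairs-++-universal [] ys [] pys = pys
AllPairs-++-universal (x ∷ xs) ys (f ∷ fs) pys = All.universal f (xs ++ ys) ∷ AllPairs-++-universal xs ys fs pys

Col1Rule-oneRows : ∀ k → All (λ a → ∀ r' → Col1Rule a r') (oneRows k)
Col1Rule-oneRows k = Allₚ.replicate⁺ k (λ { r' _ (_ , s≤s ()) _ })

ColjRule-oneRows : ∀ j → 2 ≤ j → ∀ k → All (λ a → ∀ r' → ColjRule j a r') (oneRows k)
ColjRule-oneRows j j≥2 k = Allₚ.replicate⁺ k (λ r' (_ , j≤1) _ _ → <-irrefl refl (≤-trans j≥2 j≤1))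

-- From reverse hookwords to nc border strips

leadSplit : ∀ S → AllPairs _<_ S → All (0 <_) S → ∀ D → All (2 ≤_) D → Σ Lead λ o → LeadStream o (S ++ D)
leadSplit [] [] [] D D≥2 = none , D≥2
leadSplit (zero ∷ S) _ (() ∷ _) D D≥2
leadSplit (suc zero ∷ S) (1<S ∷ _) _ D D≥2 = one , S ++ D , refl , Allₚ.++⁺ 1<S D≥2
leadSplit (suc (suc h) ∷ S) (h<S ∷ _) _ D D≥2 =
  none , Allₚ.++⁺ (s≤s (s≤s z≤n) ∷ All.map (λ q → ≤-trans (s≤s (s≤s z≤n)) (<⇒≤ q)) h<S) D≥2

≡replicate-1 : ∀ D → All (_≤ 1) D → All (0 <_) D → D ≡ replicate (length D) 1
≡replicate-1 [] [] [] = refl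
≡replicate-1 (suc zero ∷ D) (_ ∷ ≤1) (_ ∷ >0) = cong (1 ∷_) (≡replicate-1 D ≤1 >0)
≡replicate-1 (suc (suc d) ∷ D) (s≤s () ∷ _) _

trailingOnes : ∀ D → AllPairs _≥_ D → All (0 <_) D →
  Σ (List ℕ) λ D₂ → Σ ℕ λ k → (D ≡ D₂ ++ replicate k 1) × All (2 ≤_) D₂ × AllPairs _≥_ D₂
trailingOnes [] [] [] = [] , 0 , refl , [] , []
trailingOnes (suc zero ∷ D) (1≥D ∷ _) (_ ∷ >0) = [] , suc (length D) , cong (1 ∷_) (≡replicate-1 D 1≥D >0) , [] , []
trailingOnes (suc (suc d) ∷ D) (d≥D ∷ D≥) (_ ∷ >0) with trailingOnes D D≥ >0
... | D₂ , k , refl , D₂≥2 , D₂≥ = suc (suc d) ∷ D₂ , k , refl , s≤s (s≤s z≤n) ∷ D₂≥2 , Allₚ.++⁻ˡ D₂ d≥D ∷ D₂≥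

reverse-increasing : ∀ xs → Linked _>_ xs → AllPairs _<_ (reverse xs)
reverse-increasing xs xs> = AllPairs-reverse⁺ xs (Linked⇒AllPairs (λ p q → <-trans q p) xs>)

reverse-decreasing : ∀ u {x} → Linked _≤_ (u ∷ʳ x) → AllPairs _≥_ (reverse u)
reverse-decreasing u u≤ = AllPairs-reverse⁺ u (proj₁ (AllPairs-∷ʳ⁻ u (Linked⇒AllPairs ≤-trans u≤)))

-- The order in which a reverse hookword applies its letters: a strictly increasing run, then a
-- weakly decreasing run of letters ≥ 2, then letters 1.
record Stream (s : List ℕ) : Set where
  constructor stream
  field
    lead : Lead
    incr decr : List ℕ
    ones : ℕ
    s≡ : s ≡ (incr ++ decr) ++ replicate ones 1
    incr-increasing : AllPairs _<_ incr
    decr-decreasing : AllPairs _≥_ decr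
    lead-stream : LeadStream lead (incr ++ decr)

hookword-stream : ∀ w → All (0 <_) w → IsReverseHookword w → Stream (reverse w)
hookword-stream w w>0 (u , x , v , refl , u≤x , x>v)
  with trailingOnes (reverse u) (reverse-decreasing u u≤x) (All-reverse⁺ u (Allₚ.++⁻ˡ u w>0))
... | D , k , D≡ , D≥2 , D≥
  with leadSplit (reverse (x ∷ v)) (reverse-increasing (x ∷ v) x>v) (All-reverse⁺ (x ∷ v) (Allₚ.++⁻ʳ u w>0)) D D≥2
... | o , ok = stream o (reverse (x ∷ v)) D k s≡ (reverse-increasing (x ∷ v) x>v) D≥ ok
  where
  open ≡-Reasoning
  s≡ : reverse (u ++ x ∷ v) ≡ (reverse (x ∷ v) ++ D) ++ replicate k 1
  s≡ = begin
    reverse (u ++ x ∷ v)                          ≡⟨ reverse-++ u (x ∷ v) ⟩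
    reverse (x ∷ v) ++ reverse u                  ≡⟨ cong (reverse (x ∷ v) ++_) D≡ ⟩
    reverse (x ∷ v) ++ D ++ replicate k 1         ≡⟨ ++-assoc (reverse (x ∷ v)) D (replicate k 1) ⟨
    (reverse (x ∷ v) ++ D) ++ replicate k 1       ∎

rows⇒NCBorderStrip : ∀ α → All (0 <_) α → ∀ o S D k ys w → AllPairs _<_ S → AllPairs _≥_ D →
  runRows (leadRow o ++ α) (S ++ D) ≡ just ys → reverse w ≡ (S ++ D) ++ replicate k 1 → IsConnected w →
  IsNCBorderStrip (replicate k 1 ++ ys) α
rows⇒NCBorderStrip α α>0 o S D k ys w S< D≥ runRows≡ w≡ conn =
  NCRows⇒NCBorderStrip α (replicate k 1 ++ ys) (length-≤-stacked k o α ys length-ys) (subst NCRows (sym skew≡) nc-rows)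
  where
  module T = RowDecomposition (runRows⇒decomposition (leadRow o ++ α) S D ys S< D≥ runRows≡)
  R≡ : T.rows ≡ zip (leadRow o ++ α) ys
  R≡ = trans (sym (zip-map-proj T.rows)) (cong₂ zip T.starts T.ends)
  length-ys : length ys ≡ length (leadRow o ++ α)
  length-ys = trans (cong length (sym T.ends))
    (trans (length-map proj₂ T.rows) (trans (sym (length-map proj₁ T.rows)) (cong length T.starts)))
  skew≡ : skewRows α (replicate k 1 ++ ys) ≡ oneRows k ++ T.rows
  skew≡ = trans (skewRows-stacked k o α ys length-ys) (cong (oneRows k ++_) (sym R≡))
  counts : ∀ c → mult c w ≡ colSize (oneRows k ++ T.rows) c
  counts c = trans (sym (mult-reverse c w)) (trans (cong (mult c) w≡) (mult-stacked (S ++ D) k T.rows T.counts c))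
  nc-rows : NCRows (oneRows k ++ T.rows)
  nc-rows =
    connected⇒interval counts conn ,
    AllPairs-++-universal (oneRows k) T.rows (Col1Rule-oneRows k)
      (subst (AllPairs Col1Rule) (sym R≡) (Col1Rule-lead o α ys α>0)) ,
    λ j j≥2 → AllPairs-++-universal (oneRows k) T.rows (ColjRule-oneRows j j≥2 k)
      (ColjRule-topmost j T.rows T.pairs-topmost)

A⇒B : ∀ α → IsComposition α → ∀ n → 0 < n → ∀ β → InA α n β → InB α n β
A⇒B α α>0 n n>0 β (w , (w>0 , length-w , hook , conn) , act≡β) =
  run⇒<c (reverse w) α β (subst (0 <_) (sym length-s) n>0) run≡β ,
  strip ,
  trans (run-skewSize (reverse w) α β run≡β) length-s
  where
  length-s : length (reverse w) ≡ n
  length-s = trans (length-reverse w) length-w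
  run≡β : run (reverse w) α ≡ just β
  run≡β = trans (sym (act≡run-reverse w α)) act≡β
  strip : IsNCBorderStrip β α
  strip with hookword-stream w w>0 hook
  ... | stream o S D k s≡ S< D≥ ok with run-stream⇒rows o (S ++ D) k α β ok (subst (λ s → run s α ≡ just β) s≡ run≡β)
  ...   | ys , runRows≡ , β≡ =
    subst (λ β → IsNCBorderStrip β α) (sym β≡) (rows⇒NCBorderStrip α α>0 o S D k ys w S< D≥ runRows≡ s≡ conn)

-- From nc border strips to reverse hookwords

module Ascending {Q : ℕ → Set} (Q? : ∀ c → Dec (Q c)) where

  ascending : ℕ → List ℕ
  ascending zero = []
  ascending (suc m) with Q? (suc m)
  ... | yes _ = ascending m ∷ʳ suc m
  ... | no _ = ascending m

  ascending-bounds : ∀ m → All (λ c → 1 ≤ c × c ≤ m × Q c) (ascending m)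
  ascending-bounds zero = []
  ascending-bounds (suc m) with Q? (suc m)
  ... | yes q = Allₚ.∷ʳ⁺ (All.map (λ (a , b , c) → a , m≤n⇒m≤1+n b , c) (ascending-bounds m)) (s≤s z≤n , ≤-refl , q)
  ... | no _ = All.map (λ (a , b , c) → a , m≤n⇒m≤1+n b , c) (ascending-bounds m)

  ascending-increasing : ∀ m → AllPairs _<_ (ascending m)
  ascending-increasing zero = []
  ascending-increasing (suc m) with Q? (suc m)
  ... | yes q = AllPairs-∷ʳ⁺ (ascending-increasing m) (All.map (λ (_ , b , _) → s≤s b) (ascending-bounds m))
  ... | no _ = ascending-increasing m

  mult-ascending : ∀ m c → 1 ≤ c → c ≤ m → Q c → mult c (ascending m) ≡ 1
  mult-ascending zero zero () _ _
  mult-ascending (suc m) c c≥1 c≤ q with Q? (suc m) | m≤n⇒m<n∨m≡n c≤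
  ... | yes _ | inj₁ c<m+1 rewrite mult-++ c (ascending m) [ suc m ]
          | mult-≢ c (suc m) [] (λ e → <-irrefl (sym e) c<m+1) | +-identityʳ (mult c (ascending m)) =
    mult-ascending m c c≥1 (≤-pred c<m+1) q
  ... | yes _ | inj₂ refl rewrite mult-++ (suc m) (ascending m) [ suc m ] | mult-≡ (suc m) []
          | All¬⇒mult≡0 (suc m) (ascending m) (ascending-bounds m) (λ (_ , m+1≤m , _) → 1+n≰n m+1≤m) = refl
  ... | no _ | inj₁ c<m+1 = mult-ascending m c c≥1 (≤-pred c<m+1) q
  ... | no ¬q | inj₂ refl = ⊥-elim (¬q q)

  mult-¬ascending : ∀ m c → ¬ (1 ≤ c × c ≤ m × Q c) → mult c (ascending m) ≡ 0
  mult-¬ascending m c ¬q = All¬⇒mult≡0 c (ascending m) (ascending-bounds m) ¬q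

descending : (ℕ → ℕ) → ℕ → List ℕ
descending g zero = []
descending g (suc zero) = []
descending g (suc (suc m)) = replicate (g (suc (suc m))) (suc (suc m)) ++ descending g (suc m)

descending-bounds : ∀ g m → All (λ c → 2 ≤ c × c ≤ m) (descending g m)
descending-bounds g zero = []
descending-bounds g (suc zero) = []
descending-bounds g (suc (suc m)) = Allₚ.++⁺ (Allₚ.replicate⁺ _ (s≤s (s≤s z≤n) , ≤-refl))
  (All.map (λ (a , b) → a , m≤n⇒m≤1+n b) (descending-bounds g (suc m)))

AllPairs-replicate : ∀ j c → AllPairs _≥_ (replicate j c)
AllPairs-replicate zero c = []
AllPairs-replicate (suc j) c = Allₚ.replicate⁺ j ≤-refl ∷ AllPairs-replicate j c

descending-decreasing : ∀ g m → AllPairs _≥_ (descending g m)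
descending-decreasing g zero = []
descending-decreasing g (suc zero) = []
descending-decreasing g (suc (suc m)) = AllPairsₚ.++⁺ (AllPairs-replicate _ _) (descending-decreasing g (suc m))
  (Allₚ.replicate⁺ _ (All.map (λ (_ , b) → m≤n⇒m≤1+n b) (descending-bounds g (suc m))))

mult-descending : ∀ g m c → 2 ≤ c → c ≤ m → mult c (descending g m) ≡ g c
mult-descending g zero c c≥2 c≤0 with ≤-trans c≥2 c≤0
... | ()
mult-descending g (suc zero) c c≥2 c≤1 = ⊥-elim (<-irrefl refl (≤-trans c≥2 c≤1))
mult-descending g (suc (suc m)) c c≥2 c≤ =
  trans (mult-++ c (replicate (g m+2) m+2) (descending g (suc m)))
    (step (mult-descending g (suc m) c c≥2) (m≤n⇒m<n∨m≡n c≤))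
  where
  m+2 = suc (suc m)
  step : (c ≤ suc m → mult c (descending g (suc m)) ≡ g c) → c < m+2 ⊎ c ≡ m+2 →
    mult c (replicate (g m+2) m+2) + mult c (descending g (suc m)) ≡ g c
  step ih (inj₁ c<m+2) = trans (cong (_+ mult c (descending g (suc m)))
    (mult-replicate-≢ (g m+2) c m+2 (λ e → <-irrefl (sym e) c<m+2))) (ih (≤-pred c<m+2))
  step _ (inj₂ refl) = trans (cong₂ _+_ (mult-replicate-≡ (g c) c)
    (All¬⇒mult≡0 c (descending g (suc m)) (descending-bounds g (suc m)) (λ (_ , b) → <-irrefl refl b)))
    (+-identityʳ (g c))

mult-¬descending : ∀ g m c → ¬ (2 ≤ c × c ≤ m) → mult c (descending g m) ≡ 0
mult-¬descending g m c ¬b = All¬⇒mult≡0 c (descending g m) (descending-bounds g m) ¬b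

NonEmpty : Row → Set
NonEmpty (a , g) = a < g

lastColumn : List Row → ℕ
lastColumn [] = 0
lastColumn ((a , g) ∷ R) with a <? g
... | yes _ = g ⊔ lastColumn R
... | no _ = lastColumn R

InCol⇒≤lastColumn : ∀ R c → Any (InCol c) R → c ≤ lastColumn R
InCol⇒≤lastColumn ((a , g) ∷ R) c (here (p , q)) with a <? g
... | yes _ = ≤-trans q (m≤m⊔n g _)
... | no a≮g = ⊥-elim (a≮g (<-≤-trans p q))
InCol⇒≤lastColumn ((a , g) ∷ R) c (there an) with a <? g
... | yes _ = ≤-trans (InCol⇒≤lastColumn R c an) (m≤n⊔m g _)
... | no _ = InCol⇒≤lastColumn R c an

lastColumn>0⇒NonEmpty : ∀ R → 0 < lastColumn R → Any NonEmpty R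
lastColumn>0⇒NonEmpty ((a , g) ∷ R) pos with a <? g
... | yes p = here p
... | no _ = there (lastColumn>0⇒NonEmpty R pos)

lastColumn-used : ∀ R → Any NonEmpty R → Any (InCol (lastColumn R)) R
lastColumn-used ((a , g) ∷ R) ne with a <? g
... | no a≮g with ne
...   | here p = ⊥-elim (a≮g p)
...   | there ne' = there (lastColumn-used R ne')
lastColumn-used ((a , g) ∷ R) ne | yes p with ≤-total (lastColumn R) g
... | inj₁ m≤g = here (subst (a <_) (sym (m≥n⇒m⊔n≡m m≤g)) p , ≤-reflexive (m≥n⇒m⊔n≡m m≤g))
... | inj₂ g≤m = there (subst (λ z → Any (InCol z) R) (sym (m≤n⇒m⊔n≡n g≤m))
                    (lastColumn-used R (lastColumn>0⇒NonEmpty R (<-≤-trans (≤-<-trans z≤n p) g≤m))))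

sum-zip-≤ : ∀ (xs ys : List ℕ) → length xs ≡ length ys → All (λ r → proj₂ r ≤ proj₁ r) (zip xs ys) → sum ys ≤ sum xs
sum-zip-≤ [] [] _ _ = z≤n
sum-zip-≤ (x ∷ xs) (y ∷ ys) e (p ∷ ps) = +-mono-≤ p (sum-zip-≤ xs ys (suc-injective e) ps)

sum-padding : ∀ d α → sum (replicate d 0 ++ α) ≡ sum α
sum-padding zero α = refl
sum-padding (suc d) α = sum-padding d α

skewSize>0⇒NonEmpty : ∀ α β → length α ≤ length β → 0 < skewSize β α → Any NonEmpty (skewRows α β)
skewSize>0⇒NonEmpty α β le pos with any? (λ r → proj₁ r <? proj₂ r) (skewRows α β)
... | yes a = a
... | no ¬a = ⊥-elim (<-irrefl (sym (m≤n⇒m∸n≡0 β≤α)) pos)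
  where
  β≤α : sum β ≤ sum α
  β≤α = subst (sum β ≤_) (sum-padding (length β ∸ length α) α)
          (sum-zip-≤ (pad α β) β (length-pad α β le) (All.map ≮⇒≥ (Allₚ.¬Any⇒All¬ (skewRows α β) ¬a)))

PairAt : List Row → ℕ → Set
PairAt R c = Any (λ r → PairInRow r c) R

pairInRow? : ∀ r j → Dec (PairInRow r j)
pairInRow? (a , g) j = (a <? j) ×-dec (suc j ≤? g)

PairAt⇒InCol : ∀ R c → PairAt R c → Any (InCol (suc c)) R × Any (InCol c) R
PairAt⇒InCol (r ∷ R) c (here (p , q)) = here (≤-trans p (n≤1+n c) , q) , here (p , ≤-trans (n≤1+n c) q)
PairAt⇒InCol (r ∷ R) c (there a) = Product.map there there (PairAt⇒InCol R c a)

InCol⇒≥1 : ∀ R c → Any (InCol c) R → 1 ≤ c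
InCol⇒≥1 (r ∷ R) c (here (p , _)) = ≤-trans (s≤s z≤n) p
InCol⇒≥1 (r ∷ R) c (there a) = InCol⇒≥1 R c a

InCol⇒≥2 : ∀ R c → All (λ r → 1 ≤ proj₁ r) R → Any (InCol c) R → 2 ≤ c
InCol⇒≥2 (r ∷ R) c (p ∷ _) (here (q , _)) = ≤-trans (s≤s p) q
InCol⇒≥2 (r ∷ R) c (_ ∷ ps) (there a) = InCol⇒≥2 R c ps a

PairAt-self : ∀ R → All (λ r → ∀ j → PairInRow r j → PairAt R j) R
PairAt-self [] = []
PairAt-self (r ∷ R) = (λ j p → here p) ∷ All.map (λ f j p → there (f j p)) (PairAt-self R)

AllPairs-++⁻ʳ : ∀ {R : A → A → Set} xs {ys} → AllPairs R (xs ++ ys) → AllPairs R ys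
AllPairs-++⁻ʳ [] ap = ap
AllPairs-++⁻ʳ (x ∷ xs) (_ ∷ ap) = AllPairs-++⁻ʳ xs ap

All-∀ : ∀ {P : ℕ → A → Set} (Z : List A) → (∀ j → All (P j) Z) → All (λ r → ∀ j → P j r) Z
All-∀ [] f = []
All-∀ (z ∷ Z) f = (λ j → All.head (f j)) ∷ All-∀ Z (λ j → All.tail (f j))

AllPairs-∀ : ∀ {R : ℕ → A → A → Set} (Z : List A) → (∀ j → AllPairs (R j) Z) →
  AllPairs (λ r r' → ∀ j → R j r r') Z
AllPairs-∀ [] f = []
AllPairs-∀ (z ∷ Z) f = All-∀ Z (λ j → AllPairs.head (f j)) ∷ AllPairs-∀ Z (λ j → AllPairs.tail (f j))

AllPairs-later : ∀ {P : A → Set} (Z : List A) → All P Z → AllPairs (λ _ r' → P r') Z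
AllPairs-later [] [] = []
AllPairs-later (z ∷ Z) (p ∷ ps) = ps ∷ AllPairs-later Z ps

AllPairs-universal : ∀ {R : A → A → Set} (Z : List A) → (∀ r r' → R r r') → AllPairs R Z
AllPairs-universal [] f = []
AllPairs-universal (z ∷ Z) f = All.universal (f z) Z ∷ AllPairs-universal Z f

strict-∋1⇒head : ∀ L → AllPairs _<_ L → All (1 ≤_) L → 0 < mult 1 L →
  Σ (List ℕ) λ L' → (L ≡ 1 ∷ L') × All (2 ≤_) L'
strict-∋1⇒head (zero ∷ L) _ (() ∷ _) _
strict-∋1⇒head (suc zero ∷ L) (1<L ∷ _) _ _ = L , refl , 1<L
strict-∋1⇒head (suc (suc h) ∷ L) (h<L ∷ _) _ pos
  with All-mult>0 h<L (subst (0 <_) (mult-≢ 1 (suc (suc h)) L (λ ())) pos)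
... | s≤s ()

-- The three ways in which column 1 can be used, b being the last column used.
data Start (R : List Row) (b : ℕ) : Lead → Set where
  no-lead : (∀ c → PairAt R c → 2 ≤ c) → 2 ≤ b → colSize R 1 ≡ 0 → Start R b none
  lead-pair : colSize R 1 ≡ 1 → PairAt R 1 → 2 ≤ b → Start R b one
  lead-alone : colSize R 1 ≡ 1 → b ≡ 1 → Start R b one

-- The word whose letters are the columns of the boxes of F = oneRows k ++ R: the increasing part
-- lists the first columns j of two adjacent boxes j, j + 1 of a row, followed by the last column b;
-- every remaining box of R is listed in the weakly decreasing part, and the k boxes of oneRows k
-- come last as letters 1.
module Word (o : Lead) (k : ℕ) (R : List Row)
  (last-used : Any (InCol (lastColumn (oneRows k ++ R))) (oneRows k ++ R))
  (colj : ∀ j → 2 ≤ j → AllPairs (ColjRule j) (oneRows k ++ R))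
  (lower-starts : AllPairs (λ _ r' → 1 ≤ proj₁ r') R)
  (grown : Grown R) (blocked : EmptyRowsBlock R)
  (start : Start R (lastColumn (oneRows k ++ R)) o)
  where

  F = oneRows k ++ R
  b = lastColumn F

  pair? : ∀ c → Dec (PairAt R c)
  pair? c = any? (λ r → pairInRow? r c) R

  open Ascending pair?

  inner = ascending (b ∸ 1)
  incr = inner ++ [ b ]
  surplus : ℕ → ℕ
  surplus c = colSize R c ∸ mult c incr
  decr = descending surplus b
  s = (incr ++ decr) ++ replicate k 1
  w = reverse s

  b≥1 : 1 ≤ b
  b≥1 = InCol⇒≥1 F b last-used

  R⊆F : ∀ {P : Row → Set} → Any P R → Any P F
  R⊆F = Anyₚ.++⁺ʳ (oneRows k)

  beyond-b : ∀ c → b < c → colSize R c ≡ 0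
  beyond-b c b<c = ¬Any⇒colSize≡0 R c (λ a → <⇒≱ b<c (InCol⇒≤lastColumn F c (R⊆F a)))

  pair-bounds : ∀ c → PairAt R c → 1 ≤ c × c ≤ b ∸ 1
  pair-bounds c pair with PairAt⇒InCol R c pair
  ... | c+1∈ , c∈ = InCol⇒≥1 R c c∈ , ∸-monoˡ-≤ 1 (InCol⇒≤lastColumn F (suc c) (R⊆F c+1∈))

  mult-inner-pair : ∀ c → PairAt R c → mult c inner ≡ 1
  mult-inner-pair c pair = mult-ascending (b ∸ 1) c (proj₁ (pair-bounds c pair)) (proj₂ (pair-bounds c pair)) pair

  mult-inner-¬pair : ∀ c → ¬ PairAt R c → mult c inner ≡ 0
  mult-inner-¬pair c ¬pair = mult-¬ascending (b ∸ 1) c (λ (_ , _ , pair) → ¬pair pair)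

  inner<b : All (_< b) inner
  inner<b = All.map (λ (_ , c≤ , _) → below b≥1 c≤) (ascending-bounds (b ∸ 1))
    where
    below : ∀ {c b} → 1 ≤ b → c ≤ b ∸ 1 → c < b
    below {b = suc b} _ c≤b = s≤s c≤b

  incr-increasing : AllPairs _<_ incr
  incr-increasing = AllPairs-∷ʳ⁺ (ascending-increasing (b ∸ 1)) inner<b

  incr≤b : All (_≤ b) incr
  incr≤b = Allₚ.∷ʳ⁺ (All.map <⇒≤ inner<b) ≤-refl

  incr≥1 : All (1 ≤_) incr
  incr≥1 = Allₚ.∷ʳ⁺ (All.map proj₁ (ascending-bounds (b ∸ 1))) b≥1

  mult-[b] : ∀ c → c ≢ b → mult c [ b ] ≡ 0
  mult-[b] c c≢b = mult-≢ c b [] (λ e → c≢b (sym e))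

  incr⊆R : ∀ c → 2 ≤ c → 0 < mult c incr → 0 < colSize R c
  incr⊆R c c≥2 pos with c ≟ b
  ... | yes refl with Anyₚ.++⁻ (oneRows k) last-used
  ...   | inj₁ c∈ones = ⊥-elim (<-irrefl (sym (InCol-oneRows k c c∈ones)) c≥2)
  ...   | inj₂ c∈R = Any⇒colSize>0 R c c∈R
  incr⊆R c c≥2 pos | no c≢b with pair? c
  ... | yes pair = Any⇒colSize>0 R c (proj₂ (PairAt⇒InCol R c pair))
  ... | no ¬pair = ⊥-elim (<-irrefl (sym (trans (mult-++ c inner [ b ])
                      (cong₂ _+_ (mult-inner-¬pair c ¬pair) (mult-[b] c c≢b)))) pos)

  mult-incr-1 : mult 1 incr ≡ colSize R 1
  mult-incr-1 = trans (mult-++ 1 inner [ b ]) (from-start start)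
    where
    from-start : ∀ {o'} → Start R b o' → mult 1 inner + mult 1 [ b ] ≡ colSize R 1
    from-start (no-lead pairs≥2 b≥2 col1≡0) = trans (cong₂ _+_
      (mult-inner-¬pair 1 (λ pair → <-irrefl refl (pairs≥2 1 pair))) (mult-[b] 1 (λ e → <-irrefl e b≥2))) (sym col1≡0)
    from-start (lead-pair col1≡1 pair b≥2) =
      trans (cong₂ _+_ (mult-inner-pair 1 pair) (mult-[b] 1 (λ e → <-irrefl e b≥2))) (sym col1≡1)
    from-start (lead-alone col1≡1 b≡1) = trans (cong₂ _+_
      (mult-¬ascending (b ∸ 1) 1 (λ (_ , 1≤ , _) → <-irrefl refl (≤-trans 1≤ (≤-reflexive (cong (_∸ 1) b≡1)))))
      (cong (λ z → mult 1 [ z ]) b≡1)) (sym col1≡1)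

  mult-incr≤ : ∀ c → 2 ≤ c → mult c incr ≤ colSize R c
  mult-incr≤ c c≥2 with mult c incr ≟ 0
  ... | yes m≡0 = ≤-trans (≤-reflexive m≡0) z≤n
  ... | no m≢0 = ≤-trans (mult-strict≤1 c incr incr-increasing) (incr⊆R c c≥2 (n≢0⇒n>0 m≢0))

  counts : ∀ c → mult c (incr ++ decr) ≡ colSize R c
  counts c rewrite mult-++ c incr decr with 2 ≤? c | c ≤? b
  ... | yes c≥2 | yes c≤b rewrite mult-descending surplus b c c≥2 c≤b = m+[n∸m]≡n (mult-incr≤ c c≥2)
  ... | no c≱2 | _ rewrite mult-¬descending surplus b c (λ (c≥2 , _) → c≱2 c≥2) | +-identityʳ (mult c incr) = small c c≱2
    where
    small : ∀ c → ¬ 2 ≤ c → mult c incr ≡ colSize R c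
    small zero _ = trans (All¬⇒mult≡0 0 incr incr≥1 (λ ())) (sym (¬Any⇒colSize≡0 R 0 (λ a → <-irrefl refl (InCol⇒≥1 R 0 a))))
    small (suc zero) _ = mult-incr-1
    small (suc (suc c)) c≱2 = ⊥-elim (c≱2 (s≤s (s≤s z≤n)))
  ... | yes c≥2 | no c≰b rewrite mult-¬descending surplus b c (λ (_ , c≤b) → c≰b c≤b) | +-identityʳ (mult c incr) =
    trans (All¬⇒mult≡0 c incr incr≤b c≰b) (sym (beyond-b c (≰⇒> c≰b)))

  pairs-in : PairsIn incr R
  pairs-in = All.map (λ f j p → subst (0 <_) (sym (mult-++ j inner [ b ]))
    (≤-trans (≤-reflexive (sym (mult-inner-pair j (f j p)))) (m≤m+n _ _))) (PairAt-self R)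

  placed : LettersPlaced incr R
  placed c pos with pair? c
  ... | yes pair = inj₁ pair
  ... | no ¬pair = inj₂ (beyond-b (suc c) (≤-reflexive (cong suc (sym c≡b))))
    where
    c≡b : c ≡ b
    c≡b = All-mult>0 {P = _≡ b} (refl ∷ [])
      (subst (0 <_) (trans (mult-++ c inner [ b ]) (cong (_+ mult c [ b ]) (mult-inner-¬pair c ¬pair))) pos)

  pairs-topmost : PairsTopmost R
  pairs-topmost = AllPairs-∀ R topmost-at
    where
    topmost-at : ∀ j → AllPairs (λ r r' → InRow r j → PairInRow r' j → ⊥) R
    topmost-at zero = AllPairs-universal R (λ { r r' (() , _) _ })
    topmost-at (suc zero) = AllPairs.map (λ h _ (p , _) → <-irrefl refl (≤-trans (s≤s h) p)) lower-starts
    topmost-at (suc (suc j)) = AllPairs.map (λ h ir (p , q) → h ir (p , ≤-trans (n≤1+n _) q) (≤-trans p (n≤1+n _) , q))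
      (AllPairs-++⁻ʳ (oneRows k) (colj (suc (suc j)) (s≤s (s≤s z≤n))))

  runRows-rows : runRows (map proj₁ R) (incr ++ decr) ≡ just (map proj₂ R)
  runRows-rows = decomposition⇒runRows R incr decr incr-increasing (descending-decreasing surplus b)
    grown pairs-topmost blocked pairs-in placed counts

  decr≥2 : All (2 ≤_) decr
  decr≥2 = All.map proj₁ (descending-bounds surplus b)

  from-head : (Σ (List ℕ) λ L → (incr ≡ 1 ∷ L) × All (2 ≤_) L) → LeadStream one (incr ++ decr)
  from-head (L , e , L≥2) = L ++ decr , cong (_++ decr) e , Allₚ.++⁺ L≥2 decr≥2

  starts-with-1 : colSize R 1 ≡ 1 → LeadStream one (incr ++ decr)
  starts-with-1 col1≡1 = from-head (strict-∋1⇒head incr incr-increasing incr≥1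
    (subst (0 <_) (sym (trans mult-incr-1 col1≡1)) (s≤s z≤n)))

  lead-stream-from : ∀ {o'} → Start R b o' → LeadStream o' (incr ++ decr)
  lead-stream-from (no-lead pairs≥2 b≥2 _) =
    Allₚ.++⁺ (Allₚ.∷ʳ⁺ (All.map (λ (_ , _ , pair) → pairs≥2 _ pair) (ascending-bounds (b ∸ 1))) b≥2) decr≥2
  lead-stream-from (lead-pair col1≡1 _ _) = starts-with-1 col1≡1
  lead-stream-from (lead-alone col1≡1 _) = starts-with-1 col1≡1

  lead-stream : LeadStream o (incr ++ decr)
  lead-stream = lead-stream-from start

  counts-w : ∀ c → mult c w ≡ colSize F c
  counts-w c = trans (mult-reverse c s) (mult-stacked (incr ++ decr) k R counts c)

  tail = decr ++ replicate k 1

  tail-decreasing : AllPairs _≥_ tail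
  tail-decreasing = AllPairsₚ.++⁺ (descending-decreasing surplus b) (AllPairs-replicate k 1)
    (All.map (λ q → Allₚ.replicate⁺ k (≤-trans (s≤s z≤n) q)) decr≥2)

  tail≤b : All (_≤ b) tail
  tail≤b = Allₚ.++⁺ (All.map proj₂ (descending-bounds surplus b)) (Allₚ.replicate⁺ k b≥1)

  w>0 : All (0 <_) w
  w>0 = All-reverse⁺ s (Allₚ.++⁺ (Allₚ.++⁺ incr≥1 (All.map (≤-trans (s≤s z≤n)) decr≥2)) (Allₚ.replicate⁺ k ≤-refl))

  w≡ : w ≡ reverse tail ++ b ∷ reverse inner
  w≡ = begin
    reverse ((incr ++ decr) ++ replicate k 1)   ≡⟨ cong reverse (++-assoc incr decr (replicate k 1)) ⟩
    reverse ((inner ++ [ b ]) ++ tail)          ≡⟨ cong reverse (++-assoc inner [ b ] tail) ⟩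
    reverse (inner ++ b ∷ tail)                 ≡⟨ reverse-++ inner (b ∷ tail) ⟩
    reverse (b ∷ tail) ++ reverse inner         ≡⟨ cong (_++ reverse inner) (unfold-reverse b tail) ⟩
    (reverse tail ++ [ b ]) ++ reverse inner    ≡⟨ ++-assoc (reverse tail) [ b ] (reverse inner) ⟩
    reverse tail ++ b ∷ reverse inner           ∎
    where open ≡-Reasoning

  hook : IsReverseHookword w
  hook = reverse tail , b , reverse inner , w≡ ,
    AllPairs⇒Linked (AllPairs-∷ʳ⁺ (AllPairs-reverse⁺ tail tail-decreasing) (All-reverse⁺ tail tail≤b)) ,
    AllPairs⇒Linked (All-reverse⁺ inner inner<b ∷ AllPairs-reverse⁺ inner (ascending-increasing (b ∸ 1)))

newRows-shape : ∀ P Z → All (0 <_) P → AllPairs Col1Rule (zip (replicate (length P) 0) P ++ Z) →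
  (P ≡ []) ⊎ (Σ ℕ λ k → Σ ℕ λ p → P ≡ replicate k 1 ++ [ p ])
newRows-shape [] Z _ _ = inj₁ refl
newRows-shape (q ∷ []) Z _ _ = inj₂ (0 , q , refl)
newRows-shape (q ∷ q' ∷ P) Z (q>0 ∷ q'>0 ∷ P>0) ((rule ∷ _) ∷ rules) with newRows-shape (q' ∷ P) Z (q'>0 ∷ P>0) rules
... | inj₂ (k , p , e) = inj₂ (suc k , p , cong₂ _∷_ q≡1 e)
  where
  q≡1 : q ≡ 1
  q≡1 with q ≤? 1
  ... | yes q≤1 = ≤-antisym q≤1 q>0
  ... | no q≰1 = ⊥-elim (rule (s≤s z≤n , q>0) (s≤s z≤n , ≰⇒> q≰1) (s≤s z≤n , q'>0))

skewRows-++ : ∀ α P γ → length γ ≡ length α → skewRows α (P ++ γ) ≡ zip (replicate (length P) 0) P ++ zip α γ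
skewRows-++ α P γ len = trans (cong (λ d → zip (replicate d 0 ++ α) (P ++ γ)) padding)
  (zip-++ (replicate (length P) 0) P (length-replicate (length P)))
  where
  padding : length (P ++ γ) ∸ length α ≡ length P
  padding = trans (cong (_∸ length α) (trans (length-++ P) (cong (length P +_) len))) (m+n∸n≡m (length P) (length α))

replicate-∷ʳ : ∀ k (x : A) → replicate k x ∷ʳ x ≡ replicate (suc k) x
replicate-∷ʳ zero x = refl
replicate-∷ʳ (suc k) x = cong (x ∷_) (replicate-∷ʳ k x)

module FromStrip (α : List ℕ) (α>0 : All (0 <_) α) (n : ℕ) (n>0 : 0 < n) (P γ : List ℕ)
  (length-γ : length γ ≡ length α) (P>0 : All (0 <_) P) (grown : Grown (zip α γ)) (blocked : EmptyRowsBlock (zip α γ))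
  (nc : IsNCBorderStrip (P ++ γ) α) (size : skewSize (P ++ γ) α ≡ n) where

  β = P ++ γ

  α≤β : length α ≤ length β
  α≤β = subst (length α ≤_) (sym (trans (length-++ P) (cong (length P +_) length-γ))) (m≤n+m (length α) (length P))

  nc-rows : NCRows (skewRows α β)
  nc-rows = NCBorderStrip⇒NCRows α β α≤β nc

  b = lastColumn (skewRows α β)

  b-used : Any (InCol b) (skewRows α β)
  b-used = lastColumn-used (skewRows α β) (skewSize>0⇒NonEmpty α β α≤β (subst (0 <_) (sym size) n>0))

  lower-starts : All (λ r → 1 ≤ proj₁ r) (zip α γ)
  lower-starts = All-zip-proj₁ α γ α>0

  length-ys : ∀ o top → length top ≡ length (leadRow o) → length (top ++ γ) ≡ length (leadRow o ++ α)
  length-ys o top length-top = trans (length-++ top) (trans (cong₂ _+_ length-top length-γ) (sym (length-++ (leadRow o))))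

  stacked : ∀ o k top → P ≡ replicate k 1 ++ top → length top ≡ length (leadRow o) →
    skewRows α β ≡ oneRows k ++ zip (leadRow o ++ α) (top ++ γ)
  stacked o k top P≡ length-top = trans (cong (skewRows α) (trans (cong (_++ γ) P≡) (++-assoc (replicate k 1) top γ)))
    (skewRows-stacked k o α (top ++ γ) (length-ys o top length-top))

  word : ∀ o k top → P ≡ replicate k 1 ++ top → length top ≡ length (leadRow o) →
    let R = zip (leadRow o ++ α) (top ++ γ) in
    AllPairs (λ _ r' → 1 ≤ proj₁ r') R → Grown R → EmptyRowsBlock R → Start R b o → InA α n β
  word o k top P≡ length-top lower-starts' grown' blocked' start =
    W.w , (W.w>0 , length-w , W.hook , interval⇒connected W.counts-w (proj₁ nc-rows')) , act≡
    where
    R = zip (leadRow o ++ α) (top ++ γ)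
    skew≡ = stacked o k top P≡ length-top
    nc-rows' : NCRows (oneRows k ++ R)
    nc-rows' = subst NCRows skew≡ nc-rows
    module W = Word o k R (subst (λ F → Any (InCol (lastColumn F)) F) skew≡ b-used) (proj₂ (proj₂ nc-rows'))
                 lower-starts' grown' blocked' (subst (λ b → Start R b o) (cong lastColumn skew≡) start)
    len = sym (length-ys o top length-top)
    runRows≡ : runRows (leadRow o ++ α) (W.incr ++ W.decr) ≡ just (top ++ γ)
    runRows≡ = subst₂ (λ xs ys → runRows xs (W.incr ++ W.decr) ≡ just ys)
      (map-proj₁-zip (leadRow o ++ α) (top ++ γ) len) (map-proj₂-zip (leadRow o ++ α) (top ++ γ) len) W.runRows-rows
    run≡ : run (reverse W.w) α ≡ just β
    run≡ = begin
      run (reverse W.w) α                                          ≡⟨ cong (λ s → run s α) (reverse-involutive W.s) ⟩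
      run W.s α                                                    ≡⟨ run-stream o (W.incr ++ W.decr) k α W.lead-stream ⟩
      Maybe.map (replicate k 1 ++_) (runRows (leadRow o ++ α) (W.incr ++ W.decr))
                                                                   ≡⟨ cong (Maybe.map (replicate k 1 ++_)) runRows≡ ⟩
      just (replicate k 1 ++ top ++ γ)                             ≡⟨ cong just (++-assoc (replicate k 1) top γ) ⟨
      just ((replicate k 1 ++ top) ++ γ)                           ≡⟨ cong (λ P → just (P ++ γ)) P≡ ⟨
      just β                                                       ∎
      where open ≡-Reasoning
    act≡ : act W.w α ≡ just β
    act≡ = trans (act≡run-reverse W.w α) run≡
    length-w : length W.w ≡ n
    length-w = trans (sym (length-reverse W.w)) (trans (sym (run-skewSize (reverse W.w) α β run≡)) size)

  no-col1 : colSize (zip α γ) 1 ≡ 0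
  no-col1 = ¬Any⇒colSize≡0 (zip α γ) 1 (λ a → <-irrefl refl (InCol⇒≥2 (zip α γ) 1 lower-starts a))

  pairs≥2 : ∀ c → PairAt (zip α γ) c → 2 ≤ c
  pairs≥2 c pair = InCol⇒≥2 (zip α γ) c lower-starts (proj₂ (PairAt⇒InCol (zip α γ) c pair))

  without-lead : ∀ k → P ≡ replicate k 1 ++ [] → 2 ≤ b → InA α n β
  without-lead k P≡ b≥2 = word none k [] P≡ refl (AllPairs-later (zip α γ) lower-starts) grown blocked
    (no-lead pairs≥2 b≥2 no-col1)

  with-lead : ∀ k p → P ≡ replicate k 1 ++ [ p ] → 1 ≤ p →
    Start (zip (leadRow one ++ α) ([ p ] ++ γ)) b one → InA α n β
  with-lead k p P≡ p≥1 start = word one k [ p ] P≡ refl (lower-starts ∷ AllPairs-later (zip α γ) lower-starts)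
    (z≤n ∷ grown) (All.universal (λ _ p≡0 _ _ → <-irrefl p≡0 p≥1) (zip α γ) ∷ blocked) start

  lead-col1 : ∀ p → 1 ≤ p → colSize (zip (leadRow one ++ α) ([ p ] ++ γ)) 1 ≡ 1
  lead-col1 p p≥1 = trans (colSize-∈ (0 , p) (zip α γ) 1 (s≤s z≤n , p≥1)) (cong suc no-col1)

  result : InA α n β
  result with newRows-shape P (zip α γ) P>0
    (subst (AllPairs Col1Rule) (skewRows-++ α P γ length-γ) (proj₁ (proj₂ nc-rows)))
  ... | inj₁ refl = without-lead 0 refl
    (InCol⇒≥2 (zip α γ) b lower-starts (subst (Any (InCol b)) (skewRows-++ α [] γ length-γ) b-used))
  ... | inj₂ (k , p , P≡) with Allₚ.∷ʳ⁻ (subst (All (0 <_)) P≡ P>0)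
  ...   | _ , p≥1 with 2 ≤? p
  ...     | yes p≥2 = with-lead k p P≡ p≥1 (lead-pair (lead-col1 p p≥1) (here (s≤s z≤n , p≥2)) (≤-trans p≥2 p≤b))
    where
    p≤b : p ≤ b
    p≤b = InCol⇒≤lastColumn (skewRows α β) p
      (subst (Any (InCol p)) (sym (stacked one k [ p ] P≡ refl)) (Anyₚ.++⁺ʳ (oneRows k) (here (p≥1 , ≤-refl))))
  ...     | no p≱2 with b ≟ 1
  ...       | yes b≡1 = with-lead k p P≡ p≥1 (lead-alone (lead-col1 p p≥1) b≡1)
  ...       | no b≢1 = without-lead (suc k) P≡' (≤∧≢⇒< (InCol⇒≥1 (skewRows α β) b b-used) (λ e → b≢1 (sym e)))
    where
    P≡' : P ≡ replicate (suc k) 1 ++ []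
    P≡' = trans P≡ (trans (cong (λ p → replicate k 1 ∷ʳ p) (≤-antisym (≤-pred (≰⇒> p≱2)) p≥1))
            (trans (replicate-∷ʳ k 1) (sym (++-identityʳ _))))

B⇒A : ∀ α → IsComposition α → ∀ n → 0 < n → ∀ β → InB α n β → InA α n β
B⇒A α α>0 n n>0 β (α<cβ , nc , size) with reachable-<c α α (reachable-refl α) β α<cβ
... | reachable P γ refl length-γ P>0 grown blocked = FromStrip.result α α>0 n n>0 P γ length-γ P>0 grown blocked nc size

lemma5p9 : (α : List ℕ) → IsComposition α → (n : ℕ) → 0 < n →
  (β : List ℕ) → InA α n β ⇔ InB α n β
lemma5p9 α α>0 n n>0 β = mk⇔ (A⇒B α α>0 n n>0 β) (B⇒A α α>0 n n>0 β)
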